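{- Let $\mathcal{A}\subseteq\{\mathsf{N},\mathsf{M},\mathsf{C}\}$ and write $\vdash$ for derivability in $\mathsf{LNS}_{\mathsf{E}\mathcal{A}}$ extended with the contraction rules. For every $n\geq1$ (with $A^m$ denoting $m$ copies of $A$): (1) if $\vdash\mathcal{S}\{\Gamma,(\neg A)^n\Rightarrow\Delta\}$ then $\vdash\mathcal{S}\{\Gamma\Rightarrow A^{n+k},\Delta\}$ for some $k\geq0$; (2) if $\vdash\mathcal{S}\{\Gamma\Rightarrow(\neg A)^n,\Delta\}$ then $\vdash\mathcal{S}\{\Gamma,A^{n+k}\Rightarrow\Delta\}$ for some $k\geq0$; (3) if $\vdash\mathcal{S}\{\Gamma,(A\to B)^n\Rightarrow\Delta\}$ then $\vdash\mathcal{S}\{\Gamma,B^{n+k}\Rightarrow\Delta\}$ and $\vdash\mathcal{S}\{\Gamma\Rightarrow A^{n+\ell},\Delta\}$ for some $k,\ell\geq0$; (4) if $\vdash\mathcal{S}\{\Gamma\Rightarrow(A\to B)^n,\Delta\}$ then $\vdash\mathcal{S}\{\Gamma,A^{n+k}\Rightarrow B^{n+\ell},\Delta\}$ for some $k,\ell\geq0$; (5) if $\vdash\mathcal{S}\{\Gamma,(A\lor B)^n\Rightarrow\Delta\}$ then $\vdash\mathcal{S}\{\Gamma,A^{n+k}\Rightarrow\Delta\}$ and $\vdash\mathcal{S}\{\Gamma,B^{n+\ell}\Rightarrow\Delta\}$ for some $k,\ell\geq0$; (6) if $\vdash\mathcal{S}\{\Gamma\Rightarrow(A\lor B)^n,\Delta\}$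 then $\vdash\mathcal{S}\{\Gamma\Rightarrow A^{n+k},B^{n+\ell},\Delta\}$ for some $k,\ell\geq0$; (7) if $\vdash\mathcal{S}\{\Gamma,(A\land B)^n\Rightarrow\Delta\}$ then $\vdash\mathcal{S}\{\Gamma,A^{n+k},B^{n+\ell}\Rightarrow\Delta\}$ for some $k,\ell\geq0$; (8) if $\vdash\mathcal{S}\{\Gamma\Rightarrow(A\land B)^n,\Delta\}$ then $\vdash\mathcal{S}\{\Gamma\Rightarrow A^{n+k},\Delta\}$ and $\vdash\mathcal{S}\{\Gamma\Rightarrow B^{n+\ell},\Delta\}$ for some $k,\ell\geq0$. Moreover, both the depth of the derivation and the minimal level of the active components of rule applications are preserved.
   Context: Formulas: propositional variables, $\bot,\top,\neg,\land,\lor,\to,\Box$. Structures: $\mathcal{X}::=\Gamma\Rightarrow\Delta\mid\Gamma\Rightarrow\Delta\,/_{\mathsf e}(\Sigma\Rightarrow\Pi;\Omega\Rightarrow\Theta)\mid\Gamma\Rightarrow\Delta\,/\,\mathcal{X}$ with finite multisets of formulas (components); $\mathcal{S}\{\Gamma\Rightarrow\Delta\}$ has a distinguished component (in any position), $\mathcal{G}/\Gamma\Rightarrow\Delta$ has last component $\Gamma\Rightarrow\Delta$. $\mathsf{LNS}_{\mathsf{E}\mathcal{A}}$: propositional rules (zero-premiss $\mathcal{S}\{\Gamma,p\Rightarrow p,\Delta\}$ with $p$ atomic, $\mathcal{S}\{\Gamma,\bot\Rightarrow\Delta\}$, $\mathcal{S}\{\Gamma\Rightarrow\top,\Delta\}$;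 $\neg_L$: $\mathcal{S}\{\Gamma\Rightarrow A,\Delta\}$ / $\mathcal{S}\{\Gamma,\neg A\Rightarrow\Delta\}$; $\neg_R$: $\mathcal{S}\{\Gamma,A\Rightarrow\Delta\}$ / $\mathcal{S}\{\Gamma\Rightarrow\neg A,\Delta\}$; $\lor_L$: $\mathcal{S}\{\Gamma,A\Rightarrow\Delta\}$, $\mathcal{S}\{\Gamma,B\Rightarrow\Delta\}$ / $\mathcal{S}\{\Gamma,A\lor B\Rightarrow\Delta\}$; $\lor_R$: $\mathcal{S}\{\Gamma\Rightarrow A,B,\Delta\}$ / $\mathcal{S}\{\Gamma\Rightarrow A\lor B,\Delta\}$; $\land_L$: $\mathcal{S}\{\Gamma,A,B\Rightarrow\Delta\}$ / $\mathcal{S}\{\Gamma,A\land B\Rightarrow\Delta\}$; $\land_R$: $\mathcal{S}\{\Gamma\Rightarrow A,\Delta\}$, $\mathcal{S}\{\Gamma\Rightarrow B,\Delta\}$ / $\mathcal{S}\{\Gamma\Rightarrow A\land B,\Delta\}$; $\to_L$: $\mathcal{S}\{\Gamma,B\Rightarrow\Delta\}$, $\mathcal{S}\{\Gamma\Rightarrow A,\Delta\}$ / $\mathcal{S}\{\Gamma,A\to B\Rightarrow\Delta\}$; $\to_R$: $\mathcal{S}\{\Gamma,A\Rightarrow B,\Delta\}$ / $\mathcal{S}\{\Gamma\Rightarrow A\to B,\Delta\}$), not applicable to sequents inside $/_{\mathsf e}$; $\Box^{\mathsf e}_R$: $\mathcal{G}/\Gamma\Rightarrow\Delta/_{\mathsf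 e}(\Rightarrow B;B\Rightarrow)$ / $\mathcal{G}/\Gamma\Rightarrow\Box B,\Delta$; $\Box^{\mathsf e}_L$: $\mathcal{G}/\Gamma\Rightarrow\Delta/\Sigma,A\Rightarrow\Pi$ and $\mathcal{G}/\Gamma\Rightarrow\Delta/\Omega\Rightarrow A,\Theta$ / $\mathcal{G}/\Gamma,\Box A\Rightarrow\Delta/_{\mathsf e}(\Sigma\Rightarrow\Pi;\Omega\Rightarrow\Theta)$; if $\mathsf{N}\in\mathcal{A}$: $\mathcal{G}/\Gamma\Rightarrow\Delta/\Rightarrow B$ / $\mathcal{G}/\Gamma\Rightarrow\Box B,\Delta$; if $\mathsf{M}\in\mathcal{A}$: $\mathcal{G}/_{\mathsf e}(\Sigma\Rightarrow\Pi;\Omega,\bot\Rightarrow\Theta)$ / $\mathcal{G}/_{\mathsf e}(\Sigma\Rightarrow\Pi;\Omega\Rightarrow\Theta)$; if $\mathsf{C}\in\mathcal{A}$: $\mathcal{G}/\Gamma\Rightarrow\Delta/_{\mathsf e}(\Sigma,A\Rightarrow\Pi;\Omega\Rightarrow\Theta)$ and $\mathcal{G}/\Gamma\Rightarrow\Delta/\Omega\Rightarrow A,\Theta$ / $\mathcal{G}/\Gamma,\Box A\Rightarrow\Delta/_{\mathsf e}(\Sigma\Rightarrow\Pi;\Omega\Rightarrow\Theta)$. Contraction: usual left/right rules inside a component. Depth: longest branch length plus one. Formulas in the $i$-th component of a structure have level $i$. -}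

module Defs where

open import Data.Nat using (ℕ; zero; suc; _+_; _≤_; _⊔_; _⊓_)
open import Data.Bool using (Bool; T)
open import Data.List using (List; []; _∷_; _++_; replicate; length)
open import Data.List.Relation.Binary.Permutation.Propositional using (_↭_)
open import Data.Product using (Σ; _×_; _,_)

infixr 40 _∧f_ _∨f_ _→f_

data Fm : Set where
  var  : ℕ → Fm
  ⊥f   : Fm
  ⊤f   : Fm
  ¬f   : Fm → Fm
  _∧f_ : Fm → Fm → Fm
  _∨f_ : Fm → Fm → Fm
  _→f_ : Fm → Fm → Fm
  □_   : Fm → Fm

-- Sequents (components).  Multisets are lists taken up to permutation
-- (see _≈_ below): every rule conclusion is matched up to _≈_.

infix 3 _⇒_
infixr 30 _^_
infixr 2 _/_

record Seq : Set where
  constructor _⇒_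
  field
    ante : List Fm
    succ : List Fm

data Str : Set where
  [_]       : Seq → Str
  _/e⟨_∣_⟩  : Seq → Seq → Seq → Str
  _/_       : Seq → Str → Str

_▹_ : List Seq → Str → Str
[]      ▹ X = X
(s ∷ G) ▹ X = s / (G ▹ X)

data _≈s_ : Seq → Seq → Set where
  seq≈ : ∀ {Γ Γ' Δ Δ'} → Γ ↭ Γ' → Δ ↭ Δ' → (Γ ⇒ Δ) ≈s (Γ' ⇒ Δ')

data _≈_ : Str → Str → Set where
  one≈  : ∀ {s s'} → s ≈s s' → [ s ] ≈ [ s' ]
  e≈    : ∀ {s s' a a' b b'} → s ≈s s' → a ≈s a' → b ≈s b' →
          (s /e⟨ a ∣ b ⟩) ≈ (s' /e⟨ a' ∣ b' ⟩)
  cons≈ : ∀ {s s' X X'} → s ≈s s' → X ≈ X' → (s / X) ≈ (s' / X')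

-- Contexts S{ } with a distinguished component in any position
-- (including the two sequents of an /e block).

data Ctx : Set where
  hole   : Ctx
  hole/e : Seq → Seq → Ctx
  hole/  : Str → Ctx
  eL     : Seq → Seq → Ctx
  eR     : Seq → Seq → Ctx
  cons   : Seq → Ctx → Ctx

plug : Ctx → Seq → Str
plug hole       t = [ t ]
plug (hole/e a b) t = t /e⟨ a ∣ b ⟩
plug (hole/ X)  t = t / X
plug (eL s b)   t = s /e⟨ t ∣ b ⟩
plug (eR s a)   t = s /e⟨ a ∣ t ⟩
plug (cons s S) t = s / plug S t

data Normal : Ctx → Set where
  n-hole   : Normal hole
  n-hole/e : ∀ {a b} → Normal (hole/e a b)
  n-hole/  : ∀ {X} → Normal (hole/ X)
  n-cons   : ∀ {s S} → Normal S → Normal (cons s S)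

-- level of the distinguished component (components numbered from 1;
-- an /e block occupies one position, after the sequent preceding it)
lev : Ctx → ℕ
lev hole         = 1
lev (hole/e _ _) = 1
lev (hole/ _)    = 1
lev (eL _ _)     = 2
lev (eR _ _)     = 2
lev (cons _ S)   = suc (lev S)

-- The calculus LNS_EA + contraction.
-- Rule 𝒜 Ps C ℓ : an instance of a rule with premisses Ps, conclusion C,
-- and ℓ = minimal level of its active components.

data Ext : Set where
  Nax Max Cax : Ext

Axioms : Set
Axioms = Ext → Bool

data Rule (𝒜 : Axioms) : List Str → Str → ℕ → Set where
  init : ∀ {S Γ Δ p} → Normal S →
    Rule 𝒜 [] (plug S (var p ∷ Γ ⇒ var p ∷ Δ)) (lev S)
  ⊥L : ∀ {S Γ Δ} → Normal S → Rule 𝒜 [] (plug S (⊥f ∷ Γ ⇒ Δ)) (lev S)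
  ⊤R : ∀ {S Γ Δ} → Normal S → Rule 𝒜 [] (plug S (Γ ⇒ ⊤f ∷ Δ)) (lev S)
  ¬L : ∀ {S Γ Δ A} → Normal S →
    Rule 𝒜 (plug S (Γ ⇒ A ∷ Δ) ∷ []) (plug S (¬f A ∷ Γ ⇒ Δ)) (lev S)
  ¬R : ∀ {S Γ Δ A} → Normal S →
    Rule 𝒜 (plug S (A ∷ Γ ⇒ Δ) ∷ []) (plug S (Γ ⇒ ¬f A ∷ Δ)) (lev S)
  ∨L : ∀ {S Γ Δ A B} → Normal S →
    Rule 𝒜 (plug S (A ∷ Γ ⇒ Δ) ∷ plug S (B ∷ Γ ⇒ Δ) ∷ [])
           (plug S ((A ∨f B) ∷ Γ ⇒ Δ)) (lev S)
  ∨R : ∀ {S Γ Δ A B} → Normal S →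
    Rule 𝒜 (plug S (Γ ⇒ A ∷ B ∷ Δ) ∷ []) (plug S (Γ ⇒ (A ∨f B) ∷ Δ)) (lev S)
  ∧L : ∀ {S Γ Δ A B} → Normal S →
    Rule 𝒜 (plug S (A ∷ B ∷ Γ ⇒ Δ) ∷ []) (plug S ((A ∧f B) ∷ Γ ⇒ Δ)) (lev S)
  ∧R : ∀ {S Γ Δ A B} → Normal S →
    Rule 𝒜 (plug S (Γ ⇒ A ∷ Δ) ∷ plug S (Γ ⇒ B ∷ Δ) ∷ [])
           (plug S (Γ ⇒ (A ∧f B) ∷ Δ)) (lev S)
  →L : ∀ {S Γ Δ A B} → Normal S →
    Rule 𝒜 (plug S (B ∷ Γ ⇒ Δ) ∷ plug S (Γ ⇒ A ∷ Δ) ∷ [])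
           (plug S ((A →f B) ∷ Γ ⇒ Δ)) (lev S)
  →R : ∀ {S Γ Δ A B} → Normal S →
    Rule 𝒜 (plug S (A ∷ Γ ⇒ B ∷ Δ) ∷ []) (plug S (Γ ⇒ (A →f B) ∷ Δ)) (lev S)
  □R : ∀ {G Γ Δ B} →
    Rule 𝒜 ((G ▹ ((Γ ⇒ Δ) /e⟨ [] ⇒ (B ∷ []) ∣ (B ∷ []) ⇒ [] ⟩)) ∷ [])
           (G ▹ [ Γ ⇒ (□ B) ∷ Δ ]) (suc (length G))
  □L : ∀ {G Γ Δ Σ' Π Ω Θ A} →
    Rule 𝒜 ((G ▹ ((Γ ⇒ Δ) / [ A ∷ Σ' ⇒ Π ])) ∷ (G ▹ ((Γ ⇒ Δ) / [ Ω ⇒ A ∷ Θ ])) ∷ [])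
           (G ▹ (((□ A) ∷ Γ ⇒ Δ) /e⟨ Σ' ⇒ Π ∣ Ω ⇒ Θ ⟩)) (suc (length G))
  N  : ∀ {G Γ Δ B} → T (𝒜 Nax) →
    Rule 𝒜 ((G ▹ ((Γ ⇒ Δ) / [ [] ⇒ (B ∷ []) ])) ∷ [])
           (G ▹ [ Γ ⇒ (□ B) ∷ Δ ]) (suc (length G))
  M  : ∀ {G Γ Δ Σ' Π Ω Θ} → T (𝒜 Max) →
    Rule 𝒜 ((G ▹ ((Γ ⇒ Δ) /e⟨ Σ' ⇒ Π ∣ ⊥f ∷ Ω ⇒ Θ ⟩)) ∷ [])
           (G ▹ ((Γ ⇒ Δ) /e⟨ Σ' ⇒ Π ∣ Ω ⇒ Θ ⟩)) (suc (suc (length G)))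
  C  : ∀ {G Γ Δ Σ' Π Ω Θ A} → T (𝒜 Cax) →
    Rule 𝒜 ((G ▹ ((Γ ⇒ Δ) /e⟨ A ∷ Σ' ⇒ Π ∣ Ω ⇒ Θ ⟩)) ∷ (G ▹ ((Γ ⇒ Δ) / [ Ω ⇒ A ∷ Θ ])) ∷ [])
           (G ▹ (((□ A) ∷ Γ ⇒ Δ) /e⟨ Σ' ⇒ Π ∣ Ω ⇒ Θ ⟩)) (suc (length G))
  CtrL : ∀ {S Γ Δ A} →
    Rule 𝒜 (plug S (A ∷ A ∷ Γ ⇒ Δ) ∷ []) (plug S (A ∷ Γ ⇒ Δ)) (lev S)
  CtrR : ∀ {S Γ Δ A} →
    Rule 𝒜 (plug S (Γ ⇒ A ∷ A ∷ Δ) ∷ []) (plug S (Γ ⇒ A ∷ Δ)) (lev S)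

data Der (𝒜 : Axioms) : Str → Set
data Ders (𝒜 : Axioms) : List Str → Set

data Der 𝒜 where
  by : ∀ {Ps C X ℓ} → Rule 𝒜 Ps C ℓ → X ≈ C → Ders 𝒜 Ps → Der 𝒜 X

data Ders 𝒜 where
  []  : Ders 𝒜 []
  _∷_ : ∀ {X Xs} → Der 𝒜 X → Ders 𝒜 Xs → Ders 𝒜 (X ∷ Xs)

depth  : ∀ {𝒜 X} → Der 𝒜 X → ℕ
depths : ∀ {𝒜 Xs} → Ders 𝒜 Xs → ℕ
depth (by _ _ ds) = suc (depths ds)
depths []       = 0
depths (d ∷ ds) = depth d ⊔ depths ds

minLevel  : ∀ {𝒜 X} → Der 𝒜 X → ℕ
minLevels : ∀ {𝒜 Xs} → ℕ → Ders 𝒜 Xs → ℕ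
minLevel (by {ℓ = ℓ} _ _ ds) = minLevels ℓ ds
minLevels acc []       = acc
minLevels acc (d ∷ ds) = minLevels (acc ⊓ minLevel d) ds

Pres : ∀ {𝒜 X Y} → Der 𝒜 X → Der 𝒜 Y → Set
Pres D D' = depth D' ≤ depth D × minLevel D ≤ minLevel D'

_⊢≼_ : ∀ {𝒜 X} → Der 𝒜 X → Str → Set
_⊢≼_ {𝒜} D Y = Σ (Der 𝒜 Y) (λ D' → Pres D D')

_^_ : Fm → ℕ → List Fm
A ^ m = replicate m A

Part1 Part2 Part3 Part4 Part5 Part6 Part7 Part8 : Axioms → ℕ → Set
Part1 𝒜 n = ∀ S Γ Δ A (D : Der 𝒜 (plug S (Γ ++ (¬f A) ^ n ⇒ Δ))) →
  Σ ℕ λ k → D ⊢≼ plug S (Γ ⇒ A ^ (n + k) ++ Δ)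
Part2 𝒜 n = ∀ S Γ Δ A (D : Der 𝒜 (plug S (Γ ⇒ (¬f A) ^ n ++ Δ))) →
  Σ ℕ λ k → D ⊢≼ plug S (Γ ++ A ^ (n + k) ⇒ Δ)
Part3 𝒜 n = ∀ S Γ Δ A B (D : Der 𝒜 (plug S (Γ ++ (A →f B) ^ n ⇒ Δ))) →
  Σ ℕ λ k → Σ ℕ λ l →
    (D ⊢≼ plug S (Γ ++ B ^ (n + k) ⇒ Δ)) × (D ⊢≼ plug S (Γ ⇒ A ^ (n + l) ++ Δ))
Part4 𝒜 n = ∀ S Γ Δ A B (D : Der 𝒜 (plug S (Γ ⇒ (A →f B) ^ n ++ Δ))) →
  Σ ℕ λ k → Σ ℕ λ l → D ⊢≼ plug S (Γ ++ A ^ (n + k) ⇒ B ^ (n + l) ++ Δ)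
Part5 𝒜 n = ∀ S Γ Δ A B (D : Der 𝒜 (plug S (Γ ++ (A ∨f B) ^ n ⇒ Δ))) →
  Σ ℕ λ k → Σ ℕ λ l →
    (D ⊢≼ plug S (Γ ++ A ^ (n + k) ⇒ Δ)) × (D ⊢≼ plug S (Γ ++ B ^ (n + l) ⇒ Δ))
Part6 𝒜 n = ∀ S Γ Δ A B (D : Der 𝒜 (plug S (Γ ⇒ (A ∨f B) ^ n ++ Δ))) →
  Σ ℕ λ k → Σ ℕ λ l → D ⊢≼ plug S (Γ ⇒ A ^ (n + k) ++ B ^ (n + l) ++ Δ)
Part7 𝒜 n = ∀ S Γ Δ A B (D : Der 𝒜 (plug S (Γ ++ (A ∧f B) ^ n ⇒ Δ))) →
  Σ ℕ λ k → Σ ℕ λ l → D ⊢≼ plug S (Γ ++ A ^ (n + k) ++ B ^ (n + l) ⇒ Δ)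
Part8 𝒜 n = ∀ S Γ Δ A B (D : Der 𝒜 (plug S (Γ ⇒ (A ∧f B) ^ n ++ Δ))) →
  Σ ℕ λ k → Σ ℕ λ l →
    (D ⊢≼ plug S (Γ ⇒ A ^ (n + k) ++ Δ)) × (D ⊢≼ plug S (Γ ⇒ B ^ (n + l) ++ Δ))

-- An occurrence of F is inverted together with all its copies in one
-- component, by induction on the derivation.  If no tracked copy is principal
-- in the last rule, that rule is reapplied to the premisses with the copies
-- replaced; the premisses may contain them in other components, so components
-- are addressed by index rather than by context.  Boxed formulas are never
-- tracked, so the modal rules always commute.  A principal copy is either
-- decomposed, and the hypothesis for the premiss with n - 1 copies applies, or
-- contracted, and the hypothesis for n + 1 copies applies.  Contraction is why
-- the result has n + k copies, and every k beyond some k₀ is provided so that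
-- the premisses of a rule can be brought to a common k.

module Submission where

open import Defs
open import Data.Nat using (ℕ; zero; suc; _+_; _≤_; _<_; _⊔_; _⊓_; z≤n; s≤s) renaming (_≟_ to _≟ℕ_)
open import Data.Nat.Properties
  using (≤-refl; ≤-trans; ⊔-mono-≤; ⊓-mono-≤; m⊓n≤m; m⊓n≤n; m⊔n≤o⇒m≤o; m⊔n≤o⇒n≤o; m≤m⊔n; m≤n⊔m;
         +-suc; n≤1+n)
open import Data.List using (List; []; _∷_; _++_; length; map)
open import Data.List.Properties using (++-assoc; ++-identityʳ)
open import Data.List.Relation.Binary.Permutation.Propositional using (_↭_; ↭-refl; ↭-sym; ↭-trans; ↭-reflexive; prep)
open import Data.List.Relation.Binary.Permutation.Propositional.Properties
  using (∈-resp-↭; drop-mid; drop-∷; shift; shifts; ++⁺ˡ; ++⁺ʳ; ++-comm)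
open import Data.List.Relation.Binary.Pointwise using (Pointwise; []; _∷_)
open import Data.List.Membership.Propositional using (_∈_; _∉_)
open import Data.List.Membership.Propositional.Properties using (∈-map⁺; ∈-++⁻; ∈-∃++)
open import Data.List.Relation.Unary.Any using (here; there)
open import Data.List.Relation.Unary.All using (All; []; _∷_)
open import Data.Product using (Σ; _×_; _,_; proj₁; proj₂)
open import Data.Sum using (_⊎_; inj₁; inj₂)
open import Data.Empty using (⊥-elim)
open import Data.Unit using (⊤; tt)
open import Data.Bool using (T)
open import Data.Maybe using (Maybe; just; nothing)
open import Data.Maybe.Properties using (just-injective)
open import Relation.Nullary using (yes; no)
open import Relation.Binary.PropositionalEquality using (_≡_; _≢_; refl; sym; trans; cong; subst)

≈s-refl : ∀ {s} → s ≈s s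
≈s-refl {Γ ⇒ Δ} = seq≈ ↭-refl ↭-refl

≈s-sym : ∀ {s t} → s ≈s t → t ≈s s
≈s-sym (seq≈ p q) = seq≈ (↭-sym p) (↭-sym q)

≈s-trans : ∀ {s t u} → s ≈s t → t ≈s u → s ≈s u
≈s-trans (seq≈ p q) (seq≈ p' q') = seq≈ (↭-trans p p') (↭-trans q q')

≈-refl : ∀ {X} → X ≈ X
≈-refl {[ s ]}           = one≈ ≈s-refl
≈-refl {s /e⟨ a ∣ b ⟩} = e≈ ≈s-refl ≈s-refl ≈s-refl
≈-refl {s / X}           = cons≈ ≈s-refl ≈-refl

≈-sym : ∀ {X Y} → X ≈ Y → Y ≈ X
≈-sym (one≈ p)     = one≈ (≈s-sym p)
≈-sym (e≈ p q r)   = e≈ (≈s-sym p) (≈s-sym q) (≈s-sym r)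
≈-sym (cons≈ p q)  = cons≈ (≈s-sym p) (≈-sym q)

≈-trans : ∀ {X Y Z} → X ≈ Y → Y ≈ Z → X ≈ Z
≈-trans (one≈ p)    (one≈ p')      = one≈ (≈s-trans p p')
≈-trans (e≈ p q r)  (e≈ p' q' r')  = e≈ (≈s-trans p p') (≈s-trans q q') (≈s-trans r r')
≈-trans (cons≈ p q) (cons≈ p' q')  = cons≈ (≈s-trans p p') (≈-trans q q')

≈-reflexive : ∀ {X Y} → X ≡ Y → X ≈ Y
≈-reflexive refl = ≈-refl

-- Components of a structure are numbered from 0, the two sequents of an
-- /e block getting consecutive numbers.
component : Str → ℕ → Maybe Seq
component [ s ]               zero                = just s
component [ s ]               (suc i)             = nothing
component (s /e⟨ a ∣ b ⟩)   zero                = just s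
component (s /e⟨ a ∣ b ⟩)   (suc zero)          = just a
component (s /e⟨ a ∣ b ⟩)   (suc (suc zero))    = just b
component (s /e⟨ a ∣ b ⟩)   (suc (suc (suc i))) = nothing
component (s / X)             zero                = just s
component (s / X)             (suc i)             = component X i

update : Str → ℕ → Seq → Str
update [ s ]             zero                w = [ w ]
update [ s ]             (suc i)             w = [ s ]
update (s /e⟨ a ∣ b ⟩) zero                w = w /e⟨ a ∣ b ⟩
update (s /e⟨ a ∣ b ⟩) (suc zero)          w = s /e⟨ w ∣ b ⟩
update (s /e⟨ a ∣ b ⟩) (suc (suc zero))    w = s /e⟨ a ∣ w ⟩
update (s /e⟨ a ∣ b ⟩) (suc (suc (suc i))) w = s /e⟨ a ∣ b ⟩
update (s / X)           zero                w = w / X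
update (s / X)           (suc i)             w = s / update X i w

component-≈ : ∀ {X Y} i {t} → X ≈ Y → component X i ≡ just t →
              Σ Seq λ t' → component Y i ≡ just t' × t ≈s t'
component-≈ zero                (one≈ p)    refl = _ , refl , p
component-≈ (suc i)             (one≈ p)    ()
component-≈ zero                (e≈ p q r)  refl = _ , refl , p
component-≈ (suc zero)          (e≈ p q r)  refl = _ , refl , q
component-≈ (suc (suc zero))    (e≈ p q r)  refl = _ , refl , r
component-≈ (suc (suc (suc i))) (e≈ p q r)  ()
component-≈ zero                (cons≈ p q) refl = _ , refl , p
component-≈ (suc i)             (cons≈ p q) c    = component-≈ i q c

update-cong : ∀ {X Y} i {u v} → X ≈ Y → u ≈s v → update X i u ≈ update Y i v
update-cong zero                (one≈ p)    e = one≈ e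
update-cong (suc i)             (one≈ p)    e = one≈ p
update-cong zero                (e≈ p q r)  e = e≈ e q r
update-cong (suc zero)          (e≈ p q r)  e = e≈ p e r
update-cong (suc (suc zero))    (e≈ p q r)  e = e≈ p q e
update-cong (suc (suc (suc i))) (e≈ p q r)  e = e≈ p q r
update-cong zero                (cons≈ p q) e = cons≈ e q
update-cong (suc i)             (cons≈ p q) e = cons≈ p (update-cong i q e)

position : Ctx → ℕ
position hole         = zero
position (hole/e _ _) = zero
position (hole/ _)    = zero
position (eL _ _)     = suc zero
position (eR _ _)     = suc (suc zero)
position (cons _ S)   = suc (position S)

component-plug : ∀ S t → component (plug S t) (position S) ≡ just t
component-plug hole         t = refl
component-plug (hole/e a b) t = refl
component-plug (hole/ X)    t = refl
component-plug (eL s b)     t = refl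
component-plug (eR s a)     t = refl
component-plug (cons s S)   t = component-plug S t

update-plug : ∀ S t w → update (plug S t) (position S) w ≡ plug S w
update-plug hole         t w = refl
update-plug (hole/e a b) t w = refl
update-plug (hole/ X)    t w = refl
update-plug (eL s b)     t w = refl
update-plug (eR s a)     t w = refl
update-plug (cons s S)   t w = cong (s /_) (update-plug S t w)

plug-cong : ∀ S {u v} → u ≈s v → plug S u ≈ plug S v
plug-cong hole         e = one≈ e
plug-cong (hole/e a b) e = e≈ e ≈s-refl ≈s-refl
plug-cong (hole/ X)    e = cons≈ e ≈-refl
plug-cong (eL s b)     e = e≈ ≈s-refl e ≈s-refl
plug-cong (eR s a)     e = e≈ ≈s-refl ≈s-refl e
plug-cong (cons s S)   e = cons≈ ≈s-refl (plug-cong S e)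

updateCtx : Ctx → ℕ → Seq → Ctx
updateCtx hole         i                w = hole
updateCtx (hole/e a b) (suc zero)       w = hole/e w b
updateCtx (hole/e a b) (suc (suc zero)) w = hole/e a w
updateCtx (hole/e a b) _                w = hole/e a b
updateCtx (hole/ X)    zero             w = hole/ X
updateCtx (hole/ X)    (suc i)          w = hole/ (update X i w)
updateCtx (eL s b)     zero             w = eL w b
updateCtx (eL s b)     (suc (suc zero)) w = eL s w
updateCtx (eL s b)     _                w = eL s b
updateCtx (eR s a)     zero             w = eR w a
updateCtx (eR s a)     (suc zero)       w = eR s w
updateCtx (eR s a)     _                w = eR s a
updateCtx (cons s S)   zero             w = cons w S
updateCtx (cons s S)   (suc i)          w = cons s (updateCtx S i w)

update-plug-≢ : ∀ S t i w → i ≢ position S → update (plug S t) i w ≡ plug (updateCtx S i w) t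
update-plug-≢ hole         t zero                w ne = ⊥-elim (ne refl)
update-plug-≢ hole         t (suc i)             w ne = refl
update-plug-≢ (hole/e a b) t zero                w ne = ⊥-elim (ne refl)
update-plug-≢ (hole/e a b) t (suc zero)          w ne = refl
update-plug-≢ (hole/e a b) t (suc (suc zero))    w ne = refl
update-plug-≢ (hole/e a b) t (suc (suc (suc i))) w ne = refl
update-plug-≢ (hole/ X)    t zero                w ne = ⊥-elim (ne refl)
update-plug-≢ (hole/ X)    t (suc i)             w ne = refl
update-plug-≢ (eL s b)     t zero                w ne = refl
update-plug-≢ (eL s b)     t (suc zero)          w ne = ⊥-elim (ne refl)
update-plug-≢ (eL s b)     t (suc (suc zero))    w ne = refl
update-plug-≢ (eL s b)     t (suc (suc (suc i))) w ne = refl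
update-plug-≢ (eR s a)     t zero                w ne = refl
update-plug-≢ (eR s a)     t (suc zero)          w ne = refl
update-plug-≢ (eR s a)     t (suc (suc zero))    w ne = ⊥-elim (ne refl)
update-plug-≢ (eR s a)     t (suc (suc (suc i))) w ne = refl
update-plug-≢ (cons s S)   t zero                w ne = refl
update-plug-≢ (cons s S)   t (suc i)             w ne = cong (s /_) (update-plug-≢ S t i w (λ e → ne (cong suc e)))

component-plug-≢ : ∀ S t t' i → i ≢ position S → component (plug S t) i ≡ component (plug S t') i
component-plug-≢ hole         t t' zero                ne = ⊥-elim (ne refl)
component-plug-≢ hole         t t' (suc i)             ne = refl
component-plug-≢ (hole/e a b) t t' zero                ne = ⊥-elim (ne refl)
component-plug-≢ (hole/e a b) t t' (suc zero)          ne = refl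
component-plug-≢ (hole/e a b) t t' (suc (suc zero))    ne = refl
component-plug-≢ (hole/e a b) t t' (suc (suc (suc i))) ne = refl
component-plug-≢ (hole/ X)    t t' zero                ne = ⊥-elim (ne refl)
component-plug-≢ (hole/ X)    t t' (suc i)             ne = refl
component-plug-≢ (eL s b)     t t' zero                ne = refl
component-plug-≢ (eL s b)     t t' (suc zero)          ne = ⊥-elim (ne refl)
component-plug-≢ (eL s b)     t t' (suc (suc zero))    ne = refl
component-plug-≢ (eL s b)     t t' (suc (suc (suc i))) ne = refl
component-plug-≢ (eR s a)     t t' zero                ne = refl
component-plug-≢ (eR s a)     t t' (suc zero)          ne = refl
component-plug-≢ (eR s a)     t t' (suc (suc zero))    ne = ⊥-elim (ne refl)
component-plug-≢ (eR s a)     t t' (suc (suc (suc i))) ne = refl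
component-plug-≢ (cons s S)   t t' zero                ne = refl
component-plug-≢ (cons s S)   t t' (suc i)             ne = component-plug-≢ S t t' i (λ e → ne (cong suc e))

Normal-updateCtx : ∀ {S} i w → Normal S → Normal (updateCtx S i w)
Normal-updateCtx i                   w n-hole     = n-hole
Normal-updateCtx zero                w n-hole/e   = n-hole/e
Normal-updateCtx (suc zero)          w n-hole/e   = n-hole/e
Normal-updateCtx (suc (suc zero))    w n-hole/e   = n-hole/e
Normal-updateCtx (suc (suc (suc i))) w n-hole/e   = n-hole/e
Normal-updateCtx zero                w n-hole/    = n-hole/
Normal-updateCtx (suc i)             w n-hole/    = n-hole/
Normal-updateCtx zero                w (n-cons n) = n-cons n
Normal-updateCtx (suc i)             w (n-cons n) = n-cons (Normal-updateCtx i w n)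

lev-updateCtx : ∀ S i w → lev (updateCtx S i w) ≡ lev S
lev-updateCtx hole         i                   w = refl
lev-updateCtx (hole/e a b) zero                w = refl
lev-updateCtx (hole/e a b) (suc zero)          w = refl
lev-updateCtx (hole/e a b) (suc (suc zero))    w = refl
lev-updateCtx (hole/e a b) (suc (suc (suc i))) w = refl
lev-updateCtx (hole/ X)    zero                w = refl
lev-updateCtx (hole/ X)    (suc i)             w = refl
lev-updateCtx (eL s b)     zero                w = refl
lev-updateCtx (eL s b)     (suc zero)          w = refl
lev-updateCtx (eL s b)     (suc (suc zero))    w = refl
lev-updateCtx (eL s b)     (suc (suc (suc i))) w = refl
lev-updateCtx (eR s a)     zero                w = refl
lev-updateCtx (eR s a)     (suc zero)          w = refl
lev-updateCtx (eR s a)     (suc (suc zero))    w = refl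
lev-updateCtx (eR s a)     (suc (suc (suc i))) w = refl
lev-updateCtx (cons s S)   zero                w = refl
lev-updateCtx (cons s S)   (suc i)             w = cong suc (lev-updateCtx S i w)

updatePrefix : List Seq → ℕ → Seq → List Seq
updatePrefix []      i       w = []
updatePrefix (s ∷ G) zero    w = w ∷ G
updatePrefix (s ∷ G) (suc i) w = s ∷ updatePrefix G i w

length-updatePrefix : ∀ G i w → length (updatePrefix G i w) ≡ length G
length-updatePrefix []      i       w = refl
length-updatePrefix (s ∷ G) zero    w = refl
length-updatePrefix (s ∷ G) (suc i) w = cong suc (length-updatePrefix G i w)

data PrefixView (G : List Seq) : ℕ → Set where
  inPrefix : ∀ {i} → i < length G → PrefixView G i
  inSuffix : ∀ j → PrefixView G (length G + j)

prefixView : ∀ G i → PrefixView G i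
prefixView []      i       = inSuffix i
prefixView (s ∷ G) zero    = inPrefix (s≤s z≤n)
prefixView (s ∷ G) (suc i) with prefixView G i
... | inPrefix p = inPrefix (s≤s p)
... | inSuffix j = inSuffix j

component-▹-prefix : ∀ G i Z Z' → i < length G → component (G ▹ Z) i ≡ component (G ▹ Z') i
component-▹-prefix (s ∷ G) zero    Z Z' p       = refl
component-▹-prefix (s ∷ G) (suc i) Z Z' (s≤s p) = component-▹-prefix G i Z Z' p

update-▹-prefix : ∀ G i Z w → i < length G → update (G ▹ Z) i w ≡ (updatePrefix G i w ▹ Z)
update-▹-prefix (s ∷ G) zero    Z w p       = refl
update-▹-prefix (s ∷ G) (suc i) Z w (s≤s p) = cong (s /_) (update-▹-prefix G i Z w p)

component-▹-suffix : ∀ G j Z → component (G ▹ Z) (length G + j) ≡ component Z j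
component-▹-suffix []      j Z = refl
component-▹-suffix (s ∷ G) j Z = component-▹-suffix G j Z

update-▹-suffix : ∀ G j Z w → update (G ▹ Z) (length G + j) w ≡ (G ▹ update Z j w)
update-▹-suffix []      j Z w = refl
update-▹-suffix (s ∷ G) j Z w = cong (s /_) (update-▹-suffix G j Z w)

▹-cong : ∀ G {X Y} → X ≈ Y → (G ▹ X) ≈ (G ▹ Y)
▹-cong []      e = e
▹-cong (s ∷ G) e = cons≈ ≈s-refl (▹-cong G e)

cast : ∀ {𝒜 X Y} → Der 𝒜 X → Y ≈ X → Der 𝒜 Y
cast (by r e ds) e' = by r (≈-trans e' e) ds

Pres-cast : ∀ {𝒜 X Y} (D : Der 𝒜 X) (e : Y ≈ X) → Pres D (cast D e)
Pres-cast (by r e ds) e' = ≤-refl , ≤-refl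

Pres-refl : ∀ {𝒜 X} (D : Der 𝒜 X) → Pres D D
Pres-refl D = ≤-refl , ≤-refl

Pres-trans : ∀ {𝒜 X Y Z} {D₁ : Der 𝒜 X} {D₂ : Der 𝒜 Y} {D₃ : Der 𝒜 Z} →
             Pres D₁ D₂ → Pres D₂ D₃ → Pres D₁ D₃
Pres-trans (a , b) (c , d) = ≤-trans c a , ≤-trans b d

⊢≼-resp-≈ : ∀ {𝒜 X Y Z} {D : Der 𝒜 X} → D ⊢≼ Y → Z ≈ Y → D ⊢≼ Z
⊢≼-resp-≈ {D = D} (D' , p) e = cast D' e , Pres-trans {D₁ = D} {D₂ = D'} p (Pres-cast D' e)

data Pres* {𝒜 : Axioms} : ∀ {Ps Ps'} → Ders 𝒜 Ps → Ders 𝒜 Ps' → Set where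
  []  : Pres* [] []
  _∷_ : ∀ {X Y Ps Ps'} {d : Der 𝒜 X} {d' : Der 𝒜 Y} {ds : Ders 𝒜 Ps} {ds' : Ders 𝒜 Ps'} →
        Pres d d' → Pres* ds ds' → Pres* (d ∷ ds) (d' ∷ ds')

Pres*-trans : ∀ {𝒜 Ps Ps' Ps''} {ds : Ders 𝒜 Ps} {ds' : Ders 𝒜 Ps'} {ds'' : Ders 𝒜 Ps''} →
              Pres* ds ds' → Pres* ds' ds'' → Pres* ds ds''
Pres*-trans []       []       = []
Pres*-trans (p ∷ ps) (q ∷ qs) = Pres-trans p q ∷ Pres*-trans ps qs

depths-mono : ∀ {𝒜 Ps Ps'} {ds : Ders 𝒜 Ps} {ds' : Ders 𝒜 Ps'} → Pres* ds ds' → depths ds' ≤ depths ds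
depths-mono []            = ≤-refl
depths-mono ((a , _) ∷ p) = ⊔-mono-≤ a (depths-mono p)

minLevels-mono : ∀ {𝒜 Ps Ps'} {ds : Ders 𝒜 Ps} {ds' : Ders 𝒜 Ps'} {a a'} →
                 a ≤ a' → Pres* ds ds' → minLevels a ds ≤ minLevels a' ds'
minLevels-mono le []            = le
minLevels-mono le ((_ , b) ∷ p) = minLevels-mono (⊓-mono-≤ le b) p

minLevels-≤ : ∀ {𝒜 Ps} a (ds : Ders 𝒜 Ps) → minLevels a ds ≤ a
minLevels-≤ a []       = ≤-refl
minLevels-≤ a (d ∷ ds) = ≤-trans (minLevels-≤ (a ⊓ minLevel d) ds) (m⊓n≤m a (minLevel d))

Pres-by : ∀ {𝒜 Ps Ps' C C' X Y ℓ} (r : Rule 𝒜 Ps C ℓ) (r' : Rule 𝒜 Ps' C' ℓ) (e : X ≈ C) (e' : Y ≈ C')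
          {ds : Ders 𝒜 Ps} {ds' : Ders 𝒜 Ps'} → Pres* ds ds' → Pres (by r e ds) (by r' e' ds')
Pres-by r r' e e' p = s≤s (depths-mono p) , minLevels-mono ≤-refl p

cast* : ∀ {𝒜 Ps Ps'} (ds : Ders 𝒜 Ps) → Pointwise _≈_ Ps Ps' → Σ (Ders 𝒜 Ps') (Pres* ds)
cast* []       []       = [] , []
cast* (d ∷ ds) (e ∷ es) with cast* ds es
... | ds' , p = cast d (≈-sym e) ∷ ds' , Pres-cast d (≈-sym e) ∷ p

Below : ∀ {𝒜 Ps Y} → Ders 𝒜 Ps → Der 𝒜 Y → Set
Below ds D' = depth D' ≤ depths ds × (∀ a → minLevels a ds ≤ minLevel D')

Below-head : ∀ {𝒜 X Y Ps} (d : Der 𝒜 X) (ds : Ders 𝒜 Ps) {D' : Der 𝒜 Y} → Pres d D' → Below (d ∷ ds) D'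
Below-head d ds (dd , dm) = ≤-trans dd (m≤m⊔n (depth d) (depths ds)) ,
  λ a → ≤-trans (minLevels-≤ _ ds) (≤-trans (m⊓n≤n a (minLevel d)) dm)

Below-tail : ∀ {𝒜 X Y Ps} (d : Der 𝒜 X) (ds : Ders 𝒜 Ps) {D' : Der 𝒜 Y} → Below ds D' → Below (d ∷ ds) D'
Below-tail d ds (dd , dm) = ≤-trans dd (m≤n⊔m (depth d) (depths ds)) , λ a → dm (a ⊓ minLevel d)

Pres-Below : ∀ {𝒜 X Ps C ℓ Y} (r : Rule 𝒜 Ps C ℓ) (e : X ≈ C) (ds : Ders 𝒜 Ps) {D' : Der 𝒜 Y} →
             Below ds D' → Pres (by r e ds) D'
Pres-Below {ℓ = ℓ} r e ds (dd , dm) = ≤-trans dd (n≤1+n _) , dm ℓ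

-- Propositional rules and contraction in uniform shape: in context S, a
-- rule of kind k derives  principalˡ k ++ Γ ⇒ principalʳ k ++ Δ  from the
-- premisses  ql ++ Γ ⇒ qr ++ Δ  for (ql , qr) ∈ premisses k.

leftPremisses : Fm → List (List Fm × List Fm)
leftPremisses (¬f A)   = ([] , A ∷ []) ∷ []
leftPremisses (A ∧f B) = (A ∷ B ∷ [] , []) ∷ []
leftPremisses (A ∨f B) = (A ∷ [] , []) ∷ (B ∷ [] , []) ∷ []
leftPremisses (A →f B) = (B ∷ [] , []) ∷ ([] , A ∷ []) ∷ []
leftPremisses _        = []

rightPremisses : Fm → List (List Fm × List Fm)
rightPremisses (¬f A)   = (A ∷ [] , []) ∷ []
rightPremisses (A ∧f B) = ([] , A ∷ []) ∷ ([] , B ∷ []) ∷ []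
rightPremisses (A ∨f B) = ([] , A ∷ B ∷ []) ∷ []
rightPremisses (A →f B) = (A ∷ [] , B ∷ []) ∷ []
rightPremisses _        = []

data Logical : Fm → Set where
  ¬-logical : ∀ {A}   → Logical (¬f A)
  ∧-logical : ∀ {A B} → Logical (A ∧f B)
  ∨-logical : ∀ {A B} → Logical (A ∨f B)
  →-logical : ∀ {A B} → Logical (A →f B)

data Kind : Set where
  kInit        : ℕ → Kind
  kBotL kTopR  : Kind
  kLeft kRight : Fm → Kind
  kCtrL kCtrR  : Fm → Kind

principalˡ : Kind → List Fm
principalˡ (kInit p)  = var p ∷ []
principalˡ kBotL      = ⊥f ∷ []
principalˡ (kLeft F)  = F ∷ []
principalˡ (kCtrL A)  = A ∷ []
principalˡ _          = []

principalʳ : Kind → List Fm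
principalʳ (kInit p)  = var p ∷ []
principalʳ kTopR      = ⊤f ∷ []
principalʳ (kRight F) = F ∷ []
principalʳ (kCtrR A)  = A ∷ []
principalʳ _          = []

premisses : Kind → List (List Fm × List Fm)
premisses (kLeft F)  = leftPremisses F
premisses (kRight F) = rightPremisses F
premisses (kCtrL A)  = (A ∷ A ∷ [] , []) ∷ []
premisses (kCtrR A)  = ([] , A ∷ A ∷ []) ∷ []
premisses _          = []

Applicable : Kind → Ctx → Set
Applicable (kLeft F)  S = Logical F × Normal S
Applicable (kRight F) S = Logical F × Normal S
Applicable (kCtrL A)  S = ⊤
Applicable (kCtrR A)  S = ⊤
Applicable _          S = Normal S

Applicable-updateCtx : ∀ k {S} i w → Applicable k S → Applicable k (updateCtx S i w)
Applicable-updateCtx (kInit p)  i w n       = Normal-updateCtx i w n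
Applicable-updateCtx kBotL      i w n       = Normal-updateCtx i w n
Applicable-updateCtx kTopR      i w n       = Normal-updateCtx i w n
Applicable-updateCtx (kLeft F)  i w (l , n) = l , Normal-updateCtx i w n
Applicable-updateCtx (kRight F) i w (l , n) = l , Normal-updateCtx i w n
Applicable-updateCtx (kCtrL A)  i w _       = tt
Applicable-updateCtx (kCtrR A)  i w _       = tt

premiss : Ctx → List Fm → List Fm → List Fm × List Fm → Str
premiss S Γ Δ q = plug S (proj₁ q ++ Γ ⇒ proj₂ q ++ Δ)

conclusion : Kind → Ctx → List Fm → List Fm → Str
conclusion k S Γ Δ = plug S (principalˡ k ++ Γ ⇒ principalʳ k ++ Δ)

instanceOf : ∀ {𝒜} k {S} → Applicable k S → ∀ Γ Δ →
             Rule 𝒜 (map (premiss S Γ Δ) (premisses k)) (conclusion k S Γ Δ) (lev S)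
instanceOf (kInit p)  n               Γ Δ = init n
instanceOf kBotL      n               Γ Δ = ⊥L n
instanceOf kTopR      n               Γ Δ = ⊤R n
instanceOf (kLeft _)  (¬-logical , n) Γ Δ = ¬L n
instanceOf (kLeft _)  (∧-logical , n) Γ Δ = ∧L n
instanceOf (kLeft _)  (∨-logical , n) Γ Δ = ∨L n
instanceOf (kLeft _)  (→-logical , n) Γ Δ = →L n
instanceOf (kRight _) (¬-logical , n) Γ Δ = ¬R n
instanceOf (kRight _) (∧-logical , n) Γ Δ = ∧R n
instanceOf (kRight _) (∨-logical , n) Γ Δ = ∨R n
instanceOf (kRight _) (→-logical , n) Γ Δ = →R n
instanceOf (kCtrL A)  _               Γ Δ = CtrL
instanceOf (kCtrR A)  _               Γ Δ = CtrR

principalˡ-kind : ∀ k {F q} → F ∈ principalˡ k → q ∈ leftPremisses F → k ≡ kLeft F ⊎ k ≡ kCtrL F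
principalˡ-kind (kInit p) (here refl) ()
principalˡ-kind kBotL     (here refl) ()
principalˡ-kind (kLeft F) (here refl) _ = inj₁ refl
principalˡ-kind (kCtrL A) (here refl) _ = inj₂ refl
principalˡ-kind (kInit p) (there ())
principalˡ-kind kBotL     (there ())
principalˡ-kind (kLeft F) (there ())
principalˡ-kind (kCtrL A) (there ())

principalʳ-kind : ∀ k {F q} → F ∈ principalʳ k → q ∈ rightPremisses F → k ≡ kRight F ⊎ k ≡ kCtrR F
principalʳ-kind (kInit p)  (here refl) ()
principalʳ-kind kTopR      (here refl) ()
principalʳ-kind (kRight F) (here refl) _ = inj₁ refl
principalʳ-kind (kCtrR A)  (here refl) _ = inj₂ refl
principalʳ-kind (kInit p)  (there ())
principalʳ-kind kTopR      (there ())
principalʳ-kind (kRight F) (there ())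
principalʳ-kind (kCtrR A)  (there ())

Meets : List Fm → List Fm → Set
Meets ps X = Σ Fm λ P → P ∈ ps × P ∈ X

-- No decidable equality of formulas is needed: the permutation itself tells
-- whether a principal formula is one of the tracked occurrences X.
meets-or-splitˡ : ∀ ps {Γ' Γ X : List Fm} → ps ++ Γ' ↭ Γ ++ X →
                  Meets ps X ⊎ Σ (List Fm) λ Γ'' → Γ' ↭ Γ'' ++ X × Γ ↭ ps ++ Γ''
meets-or-splitˡ []       p = inj₂ (_ , p , ↭-refl)
meets-or-splitˡ (P ∷ ps) {Γ' = Γ'} {Γ} {X} p with ∈-++⁻ Γ (∈-resp-↭ p (here refl))
... | inj₂ P∈X = inj₁ (P , here refl , P∈X)
... | inj₁ P∈Γ with ∈-∃++ P∈Γ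
... | a , b , refl
  with meets-or-splitˡ ps {Γ' = Γ'} {a ++ b} {X}
         (↭-trans (drop-mid [] a (↭-trans p (↭-reflexive (++-assoc a (P ∷ b) X))))
                  (↭-reflexive (sym (++-assoc a b X))))
... | inj₁ (Q , Q∈ps , Q∈X) = inj₁ (Q , there Q∈ps , Q∈X)
... | inj₂ (Γ'' , q₁ , q₂)  = inj₂ (Γ'' , q₁ , ↭-trans (shift P a b) (prep P q₂))

meets-or-splitʳ : ∀ ps {Δ' Δ Y : List Fm} → ps ++ Δ' ↭ Y ++ Δ →
                  Meets ps Y ⊎ Σ (List Fm) λ Δ'' → Δ' ↭ Y ++ Δ'' × Δ ↭ ps ++ Δ''
meets-or-splitʳ ps {Δ' = Δ'} {Δ} {Y} p with meets-or-splitˡ ps (↭-trans p (++-comm Y Δ))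
... | inj₁ m                 = inj₁ m
... | inj₂ (Δ'' , q₁ , q₂)   = inj₂ (Δ'' , ↭-trans q₁ (++-comm Δ'' Y) , q₂)

-- The side formulas Γ₀ ⇒ Δ₀ of a component ql ++ Γ₀ ⇒ qr ++ Δ₀ ≈ Γ ++ X ⇒ Y ++ Δ
-- whose principal formulas ql , qr avoid X , Y.
record Residual (ql qr Γ₀ Δ₀ Γ Δ X Y : List Fm) : Set where
  constructor residual
  field
    Γ'' Δ''  : List Fm
    side     : (Γ₀ ⇒ Δ₀) ≈s (Γ'' ++ X ⇒ Y ++ Δ'')
    replaced : ∀ X' Y' → (Γ ++ X' ⇒ Y' ++ Δ) ≈s (ql ++ (Γ'' ++ X') ⇒ qr ++ (Y' ++ Δ''))

meets-or-residual : ∀ ql qr {Γ₀ Δ₀ Γ Δ X Y : List Fm} → (ql ++ Γ₀ ⇒ qr ++ Δ₀) ≈s (Γ ++ X ⇒ Y ++ Δ) →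
                    Meets ql X ⊎ Meets qr Y ⊎ Residual ql qr Γ₀ Δ₀ Γ Δ X Y
meets-or-residual ql qr {X = X} {Y} (seq≈ p q) with meets-or-splitˡ ql p | meets-or-splitʳ qr q
... | inj₁ m | _      = inj₁ m
... | inj₂ _ | inj₁ m = inj₂ (inj₁ m)
... | inj₂ (Γ'' , p₁ , p₂) | inj₂ (Δ'' , q₁ , q₂) = inj₂ (inj₂ (residual Γ'' Δ'' (seq≈ p₁ q₁)
      (λ X' Y' → seq≈ (↭-trans (++⁺ʳ X' p₂) (↭-reflexive (++-assoc ql Γ'' X')))
                      (↭-trans (++⁺ˡ Y' q₂) (shifts Y' qr)))))

NoBoxes : List Fm → Set
NoBoxes X = ∀ A → □ A ∉ X

residual-□ʳ : ∀ {B Γ₀ Δ₀ Γ Δ X Y} → NoBoxes Y → (Γ₀ ⇒ □ B ∷ Δ₀) ≈s (Γ ++ X ⇒ Y ++ Δ) →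
              Residual [] (□ B ∷ []) Γ₀ Δ₀ Γ Δ X Y
residual-□ʳ {B} nbY e with meets-or-residual [] (□ B ∷ []) e
... | inj₁ (_ , () , _)
... | inj₂ (inj₁ (_ , here refl , m)) = ⊥-elim (nbY B m)
... | inj₂ (inj₂ r) = r

residual-□ˡ : ∀ {A Γ₀ Δ₀ Γ Δ X Y} → NoBoxes X → (□ A ∷ Γ₀ ⇒ Δ₀) ≈s (Γ ++ X ⇒ Y ++ Δ) →
              Residual (□ A ∷ []) [] Γ₀ Δ₀ Γ Δ X Y
residual-□ˡ {A} nbX e with meets-or-residual (□ A ∷ []) [] e
... | inj₁ (_ , here refl , m) = ⊥-elim (nbX A m)
... | inj₂ (inj₁ (_ , () , _))
... | inj₂ (inj₂ r) = r

extend : ∀ ql qr {Σ' Π : List Fm} Γ Δ X Y → (Σ' ⇒ Π) ≈s (Γ ++ X ⇒ Y ++ Δ) →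
         (ql ++ Σ' ⇒ qr ++ Π) ≈s ((ql ++ Γ) ++ X ⇒ Y ++ (qr ++ Δ))
extend ql qr Γ Δ X Y (seq≈ p q) =
  seq≈ (↭-trans (++⁺ˡ ql p) (↭-reflexive (sym (++-assoc ql Γ X))))
       (↭-trans (++⁺ˡ qr q) (shifts qr Y))

reassociate : ∀ ql qr (Γ Δ X' Y' : List Fm) →
              ((ql ++ Γ) ++ X' ⇒ Y' ++ (qr ++ Δ)) ≈s (ql ++ (Γ ++ X') ⇒ qr ++ (Y' ++ Δ))
reassociate ql qr Γ Δ X' Y' = seq≈ (↭-reflexive (++-assoc ql Γ X')) (shifts Y' qr)

record Occurs (X Y : List Fm) (P : Str) : Set where
  constructor occurs
  field
    index : ℕ
    {seq} : Seq
    found : component P index ≡ just seq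
    Γ Δ   : List Fm
    shape : seq ≈s (Γ ++ X ⇒ Y ++ Δ)

replace : ∀ {X Y P} → Occurs X Y P → List Fm → List Fm → Str
replace {P = P} (occurs i _ Γ Δ _) X' Y' = update P i (Γ ++ X' ⇒ Y' ++ Δ)

Occurs-≈ : ∀ {X Y P Q} → P ≈ Q → Occurs X Y P → Occurs X Y Q
Occurs-≈ P≈Q (occurs i c Γ Δ e) =
  occurs i (proj₁ (proj₂ found')) Γ Δ (≈s-trans (≈s-sym (proj₂ (proj₂ found'))) e)
  where found' = component-≈ i P≈Q c

MaybeOccurs : List Fm → List Fm → Str → Set
MaybeOccurs X Y P = Maybe (Occurs X Y P)

replace? : ∀ {X Y P} → MaybeOccurs X Y P → List Fm → List Fm → Str
replace? {P = P} nothing  X' Y' = P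
replace?         (just o) X' Y' = replace o X' Y'

replace* : ∀ {X Y Ps} → All (MaybeOccurs X Y) Ps → List Fm → List Fm → List Str
replace* []       X' Y' = []
replace* (o ∷ os) X' Y' = replace? o X' Y' ∷ replace* os X' Y'

record Rule≈ (𝒜 : Axioms) (Ps : List Str) (C : Str) (ℓ : ℕ) : Set where
  constructor rule≈
  field
    {Ps'}       : List Str
    {C'}        : Str
    rule        : Rule 𝒜 Ps' C' ℓ
    premisses≈  : Pointwise _≈_ Ps Ps'
    conclusion≈ : C ≈ C'

record Commutes (𝒜 : Axioms) (X Y : List Fm) (Ps : List Str) (C : Str) (ℓ i : ℕ) (Γ Δ : List Fm) : Set where
  constructor commutes
  field
    occurrences : All (MaybeOccurs X Y) Ps
    reapply     : ∀ X' Y' → Rule≈ 𝒜 (replace* occurrences X' Y') (update C i (Γ ++ X' ⇒ Y' ++ Δ)) ℓ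

record Principal (X Y : List Fm) (Ps : List Str) (C : Str) (i : ℕ) : Set where
  constructor principal
  field
    kind   : Kind
    ctx    : Ctx
    Γ' Δ'  : List Fm
    concl  : C ≡ conclusion kind ctx Γ' Δ'
    prems  : Ps ≡ map (premiss ctx Γ' Δ') (premisses kind)
    atHole : i ≡ position ctx
    meets  : Meets (principalˡ kind) X ⊎ Meets (principalʳ kind) Y

occurrences-map : ∀ {A : Set} {X Y} (f : A → Str) → (∀ q → Occurs X Y (f q)) →
                  ∀ L → All (MaybeOccurs X Y) (map f L)
occurrences-map f occ []      = []
occurrences-map f occ (q ∷ L) = just (occ q) ∷ occurrences-map f occ L

replace*-map : ∀ {A : Set} {X Y} (f g : A → Str) (occ : ∀ q → Occurs X Y (f q)) {X' Y'} →
               (∀ q → replace (occ q) X' Y' ≈ g q) →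
               ∀ L → Pointwise _≈_ (replace* (occurrences-map f occ L) X' Y') (map g L)
replace*-map f g occ eq []      = []
replace*-map f g occ eq (q ∷ L) = eq q ∷ replace*-map f g occ eq L

module _ {𝒜 : Axioms} where

  commute-elsewhere : ∀ k {S} → Applicable k S → ∀ Γ' Δ' {X Y} (o : Occurs X Y (conclusion k S Γ' Δ')) →
                      Occurs.index o ≢ position S →
                      Commutes 𝒜 X Y (map (premiss S Γ' Δ') (premisses k)) (conclusion k S Γ' Δ') (lev S)
                        (Occurs.index o) (Occurs.Γ o) (Occurs.Δ o)
  commute-elsewhere k {S} ok Γ' Δ' (occurs i c Γ Δ e) i≢ = commutes
    (occurrences-map (premiss S Γ' Δ') (λ _ → occurs i (trans (component-plug-≢ S _ _ i i≢) c) Γ Δ e) (premisses k))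
    (λ X' Y' → rule≈
      (subst (Rule 𝒜 _ _) (lev-updateCtx S i _) (instanceOf k (Applicable-updateCtx k i _ ok) Γ' Δ'))
      (replace*-map _ _ _ (λ _ → ≈-reflexive (update-plug-≢ S _ i _ i≢)) (premisses k))
      (≈-reflexive (update-plug-≢ S _ i _ i≢)))

  commute-at-hole : ∀ k {S} → Applicable k S → ∀ Γ' Δ' {X Y Γ Δ} → Residual (principalˡ k) (principalʳ k) Γ' Δ' Γ Δ X Y →
                    Commutes 𝒜 X Y (map (premiss S Γ' Δ') (premisses k)) (conclusion k S Γ' Δ') (lev S) (position S) Γ Δ
  commute-at-hole k {S} ok Γ' Δ' {X} {Y} (residual Γ'' Δ'' side replaced) = commutes
    (occurrences-map (premiss S Γ' Δ')
      (λ q → occurs (position S) (component-plug S _) (proj₁ q ++ Γ'') (proj₂ q ++ Δ'')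
                    (extend (proj₁ q) (proj₂ q) Γ'' Δ'' X Y side))
      (premisses k))
    (λ X' Y' → rule≈ (instanceOf k ok (Γ'' ++ X') (Y' ++ Δ''))
      (replace*-map _ _ _
        (λ q → ≈-trans (≈-reflexive (update-plug S _ _)) (plug-cong S (reassociate (proj₁ q) (proj₂ q) Γ'' Δ'' X' Y')))
        (premisses k))
      (≈-trans (≈-reflexive (update-plug S _ _)) (plug-cong S (replaced X' Y'))))

  principal-or-commutes-kind : ∀ k {S} → Applicable k S → ∀ Γ' Δ' {X Y} (o : Occurs X Y (conclusion k S Γ' Δ')) →
                           Principal X Y (map (premiss S Γ' Δ') (premisses k)) (conclusion k S Γ' Δ') (Occurs.index o) ⊎
                           Commutes 𝒜 X Y (map (premiss S Γ' Δ') (premisses k)) (conclusion k S Γ' Δ') (lev S)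
                             (Occurs.index o) (Occurs.Γ o) (Occurs.Δ o)
  principal-or-commutes-kind k {S} ok Γ' Δ' o@(occurs i c Γ Δ e) with i ≟ℕ position S
  ... | no i≢ = inj₂ (commute-elsewhere k ok Γ' Δ' o i≢)
  ... | yes refl with just-injective (trans (sym c) (component-plug S _))
  ... | refl with meets-or-residual (principalˡ k) (principalʳ k) e
  ... | inj₁ m         = inj₁ (principal k S Γ' Δ' refl refl refl (inj₁ m))
  ... | inj₂ (inj₁ m)  = inj₁ (principal k S Γ' Δ' refl refl refl (inj₂ m))
  ... | inj₂ (inj₂ r)  = inj₂ (commute-at-hole k ok Γ' Δ' r)

  commute-prefix : ∀ {ℓ X Y} G (Zs : List Str) Z (o : Occurs X Y (G ▹ Z)) → Occurs.index o < length G →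
                   (∀ G' → length G' ≡ length G → Rule 𝒜 (map (G' ▹_) Zs) (G' ▹ Z) ℓ) →
                   Commutes 𝒜 X Y (map (G ▹_) Zs) (G ▹ Z) ℓ (Occurs.index o) (Occurs.Γ o) (Occurs.Δ o)
  commute-prefix G Zs Z (occurs i c Γ Δ e) i< rule = commutes
    (occurrences-map (G ▹_) (λ Z' → occurs i (trans (component-▹-prefix G i Z' Z i<) c) Γ Δ e) Zs)
    (λ X' Y' → rule≈ (rule _ (length-updatePrefix G i _))
      (replace*-map _ _ _ (λ Z' → ≈-reflexive (update-▹-prefix G i Z' _ i<)) Zs)
      (≈-reflexive (update-▹-prefix G i Z _ i<)))

  fromSuffix : ∀ G j Z {s} → component (G ▹ Z) (length G + j) ≡ just s → component Z j ≡ just s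
  fromSuffix G j Z c = trans (sym (component-▹-suffix G j Z)) c

  occursInSuffix : ∀ {X Y} G j Z {s} → component Z j ≡ just s → ∀ Γ Δ → s ≈s (Γ ++ X ⇒ Y ++ Δ) → Occurs X Y (G ▹ Z)
  occursInSuffix G j Z c Γ Δ e = occurs (length G + j) (trans (component-▹-suffix G j Z) c) Γ Δ e

  update-suffix : ∀ G j Z w → update (G ▹ Z) (length G + j) w ≈ (G ▹ update Z j w)
  update-suffix G j Z w = ≈-reflexive (update-▹-suffix G j Z w)

  commute-□R : ∀ {X Y} G Γ₀ Δ₀ B (o : Occurs X Y [ Γ₀ ⇒ □ B ∷ Δ₀ ]) → NoBoxes Y →
               Commutes 𝒜 X Y ((G ▹ ((Γ₀ ⇒ Δ₀) /e⟨ [] ⇒ B ∷ [] ∣ B ∷ [] ⇒ [] ⟩)) ∷ [])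
                 (G ▹ [ Γ₀ ⇒ □ B ∷ Δ₀ ]) (suc (length G)) (length G + Occurs.index o) (Occurs.Γ o) (Occurs.Δ o)
  commute-□R G Γ₀ Δ₀ B (occurs zero refl Γ Δ e) nbY with residual-□ʳ nbY e
  ... | residual Γ'' Δ'' side replaced = commutes (just (occursInSuffix G 0 P refl Γ'' Δ'' side) ∷ [])
      (λ X' Y' → rule≈ (□R {G = G} {Γ'' ++ X'} {Y' ++ Δ''} {B}) (update-suffix G 0 P _ ∷ [])
        (≈-trans (update-suffix G 0 [ Γ₀ ⇒ □ B ∷ Δ₀ ] _) (▹-cong G (one≈ (replaced X' Y')))))
    where P = (Γ₀ ⇒ Δ₀) /e⟨ [] ⇒ B ∷ [] ∣ B ∷ [] ⇒ [] ⟩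

  commute-N : ∀ {X Y} G Γ₀ Δ₀ B → T (𝒜 Nax) →
              (o : Occurs X Y [ Γ₀ ⇒ □ B ∷ Δ₀ ]) → NoBoxes Y →
              Commutes 𝒜 X Y ((G ▹ ((Γ₀ ⇒ Δ₀) / [ [] ⇒ B ∷ [] ])) ∷ [])
                (G ▹ [ Γ₀ ⇒ □ B ∷ Δ₀ ]) (suc (length G)) (length G + Occurs.index o) (Occurs.Γ o) (Occurs.Δ o)
  commute-N G Γ₀ Δ₀ B tN (occurs zero refl Γ Δ e) nbY with residual-□ʳ nbY e
  ... | residual Γ'' Δ'' side replaced = commutes (just (occursInSuffix G 0 P refl Γ'' Δ'' side) ∷ [])
      (λ X' Y' → rule≈ (N {G = G} {Γ'' ++ X'} {Y' ++ Δ''} {B} tN) (update-suffix G 0 P _ ∷ [])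
        (≈-trans (update-suffix G 0 [ Γ₀ ⇒ □ B ∷ Δ₀ ] _) (▹-cong G (one≈ (replaced X' Y')))))
    where P = (Γ₀ ⇒ Δ₀) / [ [] ⇒ B ∷ [] ]

  commute-□L : ∀ {X Y} G Γ₀ Δ₀ Σ' Π Ω Θ A →
               (o : Occurs X Y ((□ A ∷ Γ₀ ⇒ Δ₀) /e⟨ Σ' ⇒ Π ∣ Ω ⇒ Θ ⟩)) → NoBoxes X →
               Commutes 𝒜 X Y ((G ▹ ((Γ₀ ⇒ Δ₀) / [ A ∷ Σ' ⇒ Π ])) ∷ (G ▹ ((Γ₀ ⇒ Δ₀) / [ Ω ⇒ A ∷ Θ ])) ∷ [])
                  (G ▹ ((□ A ∷ Γ₀ ⇒ Δ₀) /e⟨ Σ' ⇒ Π ∣ Ω ⇒ Θ ⟩)) (suc (length G)) (length G + Occurs.index o) (Occurs.Γ o) (Occurs.Δ o)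
  commute-□L G Γ₀ Δ₀ Σ' Π Ω Θ A (occurs zero refl Γ Δ e) nbX with residual-□ˡ nbX e
  ... | residual Γ'' Δ'' side replaced =
    commutes (just (occursInSuffix G 0 P₁ refl Γ'' Δ'' side) ∷ just (occursInSuffix G 0 P₂ refl Γ'' Δ'' side) ∷ [])
      (λ X' Y' → rule≈ (□L {G = G} {Γ'' ++ X'} {Y' ++ Δ''} {Σ'} {Π} {Ω} {Θ} {A})
        (update-suffix G 0 P₁ _ ∷ update-suffix G 0 P₂ _ ∷ [])
        (≈-trans (update-suffix G 0 Z _) (▹-cong G (e≈ (replaced X' Y') ≈s-refl ≈s-refl))))
    where P₁ = (Γ₀ ⇒ Δ₀) / [ A ∷ Σ' ⇒ Π ]
          P₂ = (Γ₀ ⇒ Δ₀) / [ Ω ⇒ A ∷ Θ ]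
          Z  = (□ A ∷ Γ₀ ⇒ Δ₀) /e⟨ Σ' ⇒ Π ∣ Ω ⇒ Θ ⟩
  commute-□L {X} {Y} G Γ₀ Δ₀ Σ' Π Ω Θ A (occurs (suc zero) refl Γ Δ e) nbX =
    commutes (just (occursInSuffix G 1 P₁ refl (A ∷ Γ) Δ (extend (A ∷ []) [] Γ Δ X Y e)) ∷ nothing ∷ [])
      (λ X' Y' → rule≈ (□L {G = G} {Γ₀} {Δ₀} {Γ ++ X'} {Y' ++ Δ} {Ω} {Θ} {A})
        (update-suffix G 1 P₁ _ ∷ ≈-refl ∷ []) (update-suffix G 1 Z _))
    where P₁ = (Γ₀ ⇒ Δ₀) / [ A ∷ Σ' ⇒ Π ]
          Z  = (□ A ∷ Γ₀ ⇒ Δ₀) /e⟨ Σ' ⇒ Π ∣ Ω ⇒ Θ ⟩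
  commute-□L {X} {Y} G Γ₀ Δ₀ Σ' Π Ω Θ A (occurs (suc (suc zero)) refl Γ Δ e) nbX =
    commutes (nothing ∷ just (occursInSuffix G 1 P₂ refl Γ (A ∷ Δ) (extend [] (A ∷ []) Γ Δ X Y e)) ∷ [])
      (λ X' Y' → rule≈ (□L {G = G} {Γ₀} {Δ₀} {Σ'} {Π} {Γ ++ X'} {Y' ++ Δ} {A})
        (≈-refl ∷ ≈-trans (update-suffix G 1 P₂ _) (▹-cong G (cons≈ ≈s-refl (one≈ (reassociate [] (A ∷ []) Γ Δ X' Y')))) ∷ [])
        (update-suffix G 2 Z _))
    where P₂ = (Γ₀ ⇒ Δ₀) / [ Ω ⇒ A ∷ Θ ]
          Z  = (□ A ∷ Γ₀ ⇒ Δ₀) /e⟨ Σ' ⇒ Π ∣ Ω ⇒ Θ ⟩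

  commute-M : ∀ {X Y} G Γ₀ Δ₀ Σ' Π Ω Θ → T (𝒜 Max) →
              (o : Occurs X Y ((Γ₀ ⇒ Δ₀) /e⟨ Σ' ⇒ Π ∣ Ω ⇒ Θ ⟩)) →
              Commutes 𝒜 X Y ((G ▹ ((Γ₀ ⇒ Δ₀) /e⟨ Σ' ⇒ Π ∣ ⊥f ∷ Ω ⇒ Θ ⟩)) ∷ [])
                (G ▹ ((Γ₀ ⇒ Δ₀) /e⟨ Σ' ⇒ Π ∣ Ω ⇒ Θ ⟩)) (suc (suc (length G))) (length G + Occurs.index o) (Occurs.Γ o) (Occurs.Δ o)
  commute-M G Γ₀ Δ₀ Σ' Π Ω Θ tM (occurs zero refl Γ Δ e) =
    commutes (just (occursInSuffix G 0 P refl Γ Δ e) ∷ [])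
      (λ X' Y' → rule≈ (M {G = G} {Γ ++ X'} {Y' ++ Δ} {Σ'} {Π} {Ω} {Θ} tM)
        (update-suffix G 0 P _ ∷ []) (update-suffix G 0 Z _))
    where P = (Γ₀ ⇒ Δ₀) /e⟨ Σ' ⇒ Π ∣ ⊥f ∷ Ω ⇒ Θ ⟩
          Z = (Γ₀ ⇒ Δ₀) /e⟨ Σ' ⇒ Π ∣ Ω ⇒ Θ ⟩
  commute-M G Γ₀ Δ₀ Σ' Π Ω Θ tM (occurs (suc zero) refl Γ Δ e) =
    commutes (just (occursInSuffix G 1 P refl Γ Δ e) ∷ [])
      (λ X' Y' → rule≈ (M {G = G} {Γ₀} {Δ₀} {Γ ++ X'} {Y' ++ Δ} {Ω} {Θ} tM)
        (update-suffix G 1 P _ ∷ []) (update-suffix G 1 Z _))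
    where P = (Γ₀ ⇒ Δ₀) /e⟨ Σ' ⇒ Π ∣ ⊥f ∷ Ω ⇒ Θ ⟩
          Z = (Γ₀ ⇒ Δ₀) /e⟨ Σ' ⇒ Π ∣ Ω ⇒ Θ ⟩
  commute-M {X} {Y} G Γ₀ Δ₀ Σ' Π Ω Θ tM (occurs (suc (suc zero)) refl Γ Δ e) =
    commutes (just (occursInSuffix G 2 P refl (⊥f ∷ Γ) Δ (extend (⊥f ∷ []) [] Γ Δ X Y e)) ∷ [])
      (λ X' Y' → rule≈ (M {G = G} {Γ₀} {Δ₀} {Σ'} {Π} {Γ ++ X'} {Y' ++ Δ} tM)
        (update-suffix G 2 P _ ∷ []) (update-suffix G 2 Z _))
    where P = (Γ₀ ⇒ Δ₀) /e⟨ Σ' ⇒ Π ∣ ⊥f ∷ Ω ⇒ Θ ⟩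
          Z = (Γ₀ ⇒ Δ₀) /e⟨ Σ' ⇒ Π ∣ Ω ⇒ Θ ⟩

  commute-C : ∀ {X Y} G Γ₀ Δ₀ Σ' Π Ω Θ A → T (𝒜 Cax) →
              (o : Occurs X Y ((□ A ∷ Γ₀ ⇒ Δ₀) /e⟨ Σ' ⇒ Π ∣ Ω ⇒ Θ ⟩)) → NoBoxes X →
              Commutes 𝒜 X Y ((G ▹ ((Γ₀ ⇒ Δ₀) /e⟨ A ∷ Σ' ⇒ Π ∣ Ω ⇒ Θ ⟩)) ∷ (G ▹ ((Γ₀ ⇒ Δ₀) / [ Ω ⇒ A ∷ Θ ])) ∷ [])
                 (G ▹ ((□ A ∷ Γ₀ ⇒ Δ₀) /e⟨ Σ' ⇒ Π ∣ Ω ⇒ Θ ⟩)) (suc (length G)) (length G + Occurs.index o) (Occurs.Γ o) (Occurs.Δ o)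
  commute-C G Γ₀ Δ₀ Σ' Π Ω Θ A tC (occurs zero refl Γ Δ e) nbX with residual-□ˡ nbX e
  ... | residual Γ'' Δ'' side replaced =
    commutes (just (occursInSuffix G 0 P₁ refl Γ'' Δ'' side) ∷ just (occursInSuffix G 0 P₂ refl Γ'' Δ'' side) ∷ [])
      (λ X' Y' → rule≈ (C {G = G} {Γ'' ++ X'} {Y' ++ Δ''} {Σ'} {Π} {Ω} {Θ} {A} tC)
        (update-suffix G 0 P₁ _ ∷ update-suffix G 0 P₂ _ ∷ [])
        (≈-trans (update-suffix G 0 Z _) (▹-cong G (e≈ (replaced X' Y') ≈s-refl ≈s-refl))))
    where P₁ = (Γ₀ ⇒ Δ₀) /e⟨ A ∷ Σ' ⇒ Π ∣ Ω ⇒ Θ ⟩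
          P₂ = (Γ₀ ⇒ Δ₀) / [ Ω ⇒ A ∷ Θ ]
          Z  = (□ A ∷ Γ₀ ⇒ Δ₀) /e⟨ Σ' ⇒ Π ∣ Ω ⇒ Θ ⟩
  commute-C {X} {Y} G Γ₀ Δ₀ Σ' Π Ω Θ A tC (occurs (suc zero) refl Γ Δ e) nbX =
    commutes (just (occursInSuffix G 1 P₁ refl (A ∷ Γ) Δ (extend (A ∷ []) [] Γ Δ X Y e)) ∷ nothing ∷ [])
      (λ X' Y' → rule≈ (C {G = G} {Γ₀} {Δ₀} {Γ ++ X'} {Y' ++ Δ} {Ω} {Θ} {A} tC)
        (update-suffix G 1 P₁ _ ∷ ≈-refl ∷ []) (update-suffix G 1 Z _))
    where P₁ = (Γ₀ ⇒ Δ₀) /e⟨ A ∷ Σ' ⇒ Π ∣ Ω ⇒ Θ ⟩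
          Z  = (□ A ∷ Γ₀ ⇒ Δ₀) /e⟨ Σ' ⇒ Π ∣ Ω ⇒ Θ ⟩
  commute-C {X} {Y} G Γ₀ Δ₀ Σ' Π Ω Θ A tC (occurs (suc (suc zero)) refl Γ Δ e) nbX =
    commutes (just (occursInSuffix G 2 P₁ refl Γ Δ e) ∷
              just (occursInSuffix G 1 P₂ refl Γ (A ∷ Δ) (extend [] (A ∷ []) Γ Δ X Y e)) ∷ [])
      (λ X' Y' → rule≈ (C {G = G} {Γ₀} {Δ₀} {Σ'} {Π} {Γ ++ X'} {Y' ++ Δ} {A} tC)
        (update-suffix G 2 P₁ _ ∷
         ≈-trans (update-suffix G 1 P₂ _) (▹-cong G (cons≈ ≈s-refl (one≈ (reassociate [] (A ∷ []) Γ Δ X' Y')))) ∷ [])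
        (update-suffix G 2 Z _))
    where P₁ = (Γ₀ ⇒ Δ₀) /e⟨ A ∷ Σ' ⇒ Π ∣ Ω ⇒ Θ ⟩
          P₂ = (Γ₀ ⇒ Δ₀) / [ Ω ⇒ A ∷ Θ ]
          Z  = (□ A ∷ Γ₀ ⇒ Δ₀) /e⟨ Σ' ⇒ Π ∣ Ω ⇒ Θ ⟩

  principal-or-commutes : ∀ {Ps C ℓ X Y} → Rule 𝒜 Ps C ℓ → (o : Occurs X Y C) → NoBoxes X → NoBoxes Y →
                          Principal X Y Ps C (Occurs.index o) ⊎
                          Commutes 𝒜 X Y Ps C ℓ (Occurs.index o) (Occurs.Γ o) (Occurs.Δ o)
  principal-or-commutes (init {Γ = Γ'} {Δ'} {p} n)  o _ _ = principal-or-commutes-kind (kInit p) n Γ' Δ' o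
  principal-or-commutes (⊥L {Γ = Γ'} {Δ'} n)        o _ _ = principal-or-commutes-kind kBotL n Γ' Δ' o
  principal-or-commutes (⊤R {Γ = Γ'} {Δ'} n)        o _ _ = principal-or-commutes-kind kTopR n Γ' Δ' o
  principal-or-commutes (¬L {Γ = Γ'} {Δ'} {A} n)    o _ _ = principal-or-commutes-kind (kLeft (¬f A)) (¬-logical , n) Γ' Δ' o
  principal-or-commutes (¬R {Γ = Γ'} {Δ'} {A} n)    o _ _ = principal-or-commutes-kind (kRight (¬f A)) (¬-logical , n) Γ' Δ' o
  principal-or-commutes (∨L {Γ = Γ'} {Δ'} {A} {B} n) o _ _ = principal-or-commutes-kind (kLeft (A ∨f B)) (∨-logical , n) Γ' Δ' o
  principal-or-commutes (∨R {Γ = Γ'} {Δ'} {A} {B} n) o _ _ = principal-or-commutes-kind (kRight (A ∨f B)) (∨-logical , n) Γ' Δ' o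
  principal-or-commutes (∧L {Γ = Γ'} {Δ'} {A} {B} n) o _ _ = principal-or-commutes-kind (kLeft (A ∧f B)) (∧-logical , n) Γ' Δ' o
  principal-or-commutes (∧R {Γ = Γ'} {Δ'} {A} {B} n) o _ _ = principal-or-commutes-kind (kRight (A ∧f B)) (∧-logical , n) Γ' Δ' o
  principal-or-commutes (→L {Γ = Γ'} {Δ'} {A} {B} n) o _ _ = principal-or-commutes-kind (kLeft (A →f B)) (→-logical , n) Γ' Δ' o
  principal-or-commutes (→R {Γ = Γ'} {Δ'} {A} {B} n) o _ _ = principal-or-commutes-kind (kRight (A →f B)) (→-logical , n) Γ' Δ' o
  principal-or-commutes (CtrL {S} {Γ'} {Δ'} {A})     o _ _ = principal-or-commutes-kind (kCtrL A) {S} tt Γ' Δ' o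
  principal-or-commutes (CtrR {S} {Γ'} {Δ'} {A})     o _ _ = principal-or-commutes-kind (kCtrR A) {S} tt Γ' Δ' o
  principal-or-commutes (□R {G} {Γ₀} {Δ₀} {B}) o@(occurs i c Γ Δ e) nbX nbY with prefixView G i
  ... | inPrefix i< = inj₂ (commute-prefix G _ _ o i< (λ G' eq → subst (Rule 𝒜 _ _) (cong suc eq) (□R {G = G'})))
  ... | inSuffix j  = inj₂ (commute-□R G Γ₀ Δ₀ B (occurs j (fromSuffix G j _ c) Γ Δ e) nbY)
  principal-or-commutes (N {G} {Γ₀} {Δ₀} {B} tN) o@(occurs i c Γ Δ e) nbX nbY with prefixView G i
  ... | inPrefix i< = inj₂ (commute-prefix G _ _ o i< (λ G' eq → subst (Rule 𝒜 _ _) (cong suc eq) (N {G = G'} tN)))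
  ... | inSuffix j  = inj₂ (commute-N G Γ₀ Δ₀ B tN (occurs j (fromSuffix G j _ c) Γ Δ e) nbY)
  principal-or-commutes (□L {G} {Γ₀} {Δ₀} {Σ'} {Π} {Ω} {Θ} {A}) o@(occurs i c Γ Δ e) nbX nbY with prefixView G i
  ... | inPrefix i< = inj₂ (commute-prefix G _ _ o i< (λ G' eq → subst (Rule 𝒜 _ _) (cong suc eq) (□L {G = G'})))
  ... | inSuffix j  = inj₂ (commute-□L G Γ₀ Δ₀ Σ' Π Ω Θ A (occurs j (fromSuffix G j _ c) Γ Δ e) nbX)
  principal-or-commutes (M {G} {Γ₀} {Δ₀} {Σ'} {Π} {Ω} {Θ} tM) o@(occurs i c Γ Δ e) nbX nbY with prefixView G i
  ... | inPrefix i< = inj₂ (commute-prefix G _ _ o i< (λ G' eq → subst (Rule 𝒜 _ _) (cong (λ m → suc (suc m)) eq) (M {G = G'} tM)))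
  ... | inSuffix j  = inj₂ (commute-M G Γ₀ Δ₀ Σ' Π Ω Θ tM (occurs j (fromSuffix G j _ c) Γ Δ e))
  principal-or-commutes (C {G} {Γ₀} {Δ₀} {Σ'} {Π} {Ω} {Θ} {A} tC) o@(occurs i c Γ Δ e) nbX nbY with prefixView G i
  ... | inPrefix i< = inj₂ (commute-prefix G _ _ o i< (λ G' eq → subst (Rule 𝒜 _ _) (cong suc eq) (C {G = G'} tC)))
  ... | inSuffix j  = inj₂ (commute-C G Γ₀ Δ₀ Σ' Π Ω Θ A tC (occurs j (fromSuffix G j _ c) Γ Δ e) nbX)

copies : ℕ → List Fm → List Fm
copies zero    xs = []
copies (suc m) xs = xs ++ copies m xs

target : List Fm → List Fm → ℕ → List Fm → List Fm → Seq
target fl fr m Γ Δ = Γ ++ copies m fl ⇒ copies m fr ++ Δ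

target-cong : ∀ fl fr {m m'} Γ {Δ Δ'} → m ≡ m' → Δ ↭ Δ' → target fl fr m Γ Δ ≈s target fl fr m' Γ Δ'
target-cong fl fr {m} Γ refl p = seq≈ ↭-refl (++⁺ˡ (copies m fr) p)

target-suc : ∀ fl fr m Γ {Δ Δ'} → Δ ↭ Δ' → target fl fr (suc m) Γ Δ ≈s target fl fr m (fl ++ Γ) (fr ++ Δ')
target-suc fl fr m Γ {Δ} p =
  seq≈ (↭-trans (shifts Γ fl) (↭-reflexive (sym (++-assoc fl Γ (copies m fl)))))
       (↭-trans (↭-reflexive (++-assoc fr (copies m fr) Δ))
                (↭-trans (shifts fr (copies m fr)) (++⁺ˡ (copies m fr) (++⁺ˡ fr p))))

data Side : Set where
  left right : Side

sidePremisses : Side → Fm → List (List Fm × List Fm)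
sidePremisses left  = leftPremisses
sidePremisses right = rightPremisses

trackedˡ trackedʳ : Side → Fm → ℕ → List Fm
trackedˡ left  F n = F ^ n
trackedˡ right F n = []
trackedʳ left  F n = []
trackedʳ right F n = F ^ n

∈-replicate⁻ : ∀ {P F : Fm} n → P ∈ F ^ n → P ≡ F
∈-replicate⁻ (suc n) (here eq) = eq
∈-replicate⁻ (suc n) (there m) = ∈-replicate⁻ n m

noBoxes-^ : ∀ sd {F q} → q ∈ sidePremisses sd F → ∀ n → NoBoxes (F ^ n)
noBoxes-^ left  q n A m with ∈-replicate⁻ n m
noBoxes-^ left  () n A m | refl
noBoxes-^ right q n A m with ∈-replicate⁻ n m
noBoxes-^ right () n A m | refl

noBoxes-trackedˡ : ∀ sd {F q} → q ∈ sidePremisses sd F → ∀ n → NoBoxes (trackedˡ sd F n)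
noBoxes-trackedˡ left  q n = noBoxes-^ left q n
noBoxes-trackedˡ right q n A ()

noBoxes-trackedʳ : ∀ sd {F q} → q ∈ sidePremisses sd F → ∀ n → NoBoxes (trackedʳ sd F n)
noBoxes-trackedʳ left  q n A ()
noBoxes-trackedʳ right q n = noBoxes-^ right q n

conclude : ∀ {𝒜 X Ps C ℓ Q Y} (r : Rule 𝒜 Ps C ℓ) (eq : X ≈ C) (ds : Ders 𝒜 Ps) → Y ≈ Q →
           Σ (Der 𝒜 Q) (Below ds) → Σ (Der 𝒜 Y) (Pres (by r eq ds))
conclude r eq ds e (D' , below) = cast D' e , Pres-trans {D₁ = by r eq ds} {D₂ = D'} (Pres-Below r eq ds below) (Pres-cast D' e)

by≈ : ∀ {𝒜 X Ps C ℓ Qs Y Y'} (r : Rule 𝒜 Ps C ℓ) (eq : X ≈ C) (ds : Ders 𝒜 Ps) →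
      Rule≈ 𝒜 Qs Y' ℓ → Y ≈ Y' → Σ (Ders 𝒜 Qs) (Pres* ds) → Σ (Der 𝒜 Y) (Pres (by r eq ds))
by≈ r eq ds (rule≈ r' ps≈ c≈) e (ds' , p) with cast* ds' ps≈
... | ds'' , p' = by r' (≈-trans e c≈) ds'' , Pres-by r r' eq (≈-trans e c≈) (Pres*-trans p p')

module _ {𝒜 : Axioms} (fl fr : List Fm) where

  Inverted : ∀ {P} → Der 𝒜 P → (i n : ℕ) (Γ Δ : List Fm) → Set
  Inverted {P} D i n Γ Δ =
    Σ ℕ λ k₀ → ∀ k → k₀ ≤ k → Σ (Der 𝒜 (update P i (target fl fr (n + k) Γ Δ))) (Pres D)

  InvertedBelow : ∀ {Ps} → Ders 𝒜 Ps → Str → (i n : ℕ) (Γ Δ : List Fm) → Set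
  InvertedBelow ds Q i n Γ Δ =
    Σ ℕ λ k₀ → ∀ k → k₀ ≤ k → Σ (Der 𝒜 (update Q i (target fl fr (n + k) Γ Δ))) (Below ds)

  PremissesInverted : Side → Fm → ∀ {Ps} → Ders 𝒜 Ps → Set
  PremissesInverted sd F {Ps} ds = ∀ {Q} → Q ∈ Ps → ∀ n (o : Occurs (trackedˡ sd F n) (trackedʳ sd F n) Q) →
                                   InvertedBelow ds Q (Occurs.index o) n (Occurs.Γ o) (Occurs.Δ o)

  update-plug-swap : ∀ S {t t'} w → update (plug S t) (position S) w ≈ update (plug S t') (position S) w
  update-plug-swap S w = ≈-reflexive (trans (update-plug S _ w) (sym (update-plug S _ w)))

  principal-left : ∀ {F} → (fl , fr) ∈ leftPremisses F →
                   ∀ {X Ps C ℓ} (r : Rule 𝒜 Ps C ℓ) (eq : X ≈ C) (ds : Ders 𝒜 Ps) → PremissesInverted left F ds →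
                   ∀ n i {t} → component C i ≡ just t → ∀ Γ Δ → t ≈s (Γ ++ F ^ n ⇒ Δ) →
                   Principal (F ^ n) [] Ps C i → Inverted (by r eq ds) i n Γ Δ
  principal-left q r eq ds ih n i c Γ Δ e (principal k S Γ' Δ' refl refl refl (inj₂ (_ , _ , ())))
  principal-left q r eq ds ih zero i c Γ Δ e (principal k S Γ' Δ' refl refl refl (inj₁ (_ , _ , ())))
  principal-left {F} q r eq ds ih (suc n) i c Γ Δ e (principal k S Γ' Δ' refl refl refl (inj₁ (P , P∈k , P∈Fⁿ)))
    with ∈-replicate⁻ (suc n) P∈Fⁿ
  ... | refl with principalˡ-kind k P∈k q | just-injective (trans (sym c) (component-plug S _))
  ... | inj₁ refl | refl with e
  ... | seq≈ p p' with ih (∈-map⁺ (premiss S Γ' Δ') q) n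
        (occurs (position S) (component-plug S _) (fl ++ Γ) (fr ++ Δ')
                (extend fl fr Γ Δ' (F ^ n) [] (seq≈ (drop-mid [] Γ p) ↭-refl)))
  ... | k₀ , f = k₀ , λ k k₀≤k → conclude r eq ds
         (≈-trans (update-cong (position S) eq (target-suc fl fr (n + k) Γ (↭-sym p'))) (update-plug-swap S _))
         (f k k₀≤k)
  principal-left {F} q r eq ds ih (suc n) i c Γ Δ e (principal k S Γ' Δ' refl refl refl (inj₁ (P , P∈k , P∈Fⁿ)))
    | refl | inj₂ refl | refl with e
  ... | seq≈ p p' with ih (here refl) (suc (suc n))
        (occurs (position S) (component-plug S _) Γ Δ'
                (seq≈ (↭-trans (prep F (prep F (drop-mid [] Γ p))) (↭-sym (shifts Γ (F ∷ F ∷ [])))) ↭-refl))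
  ... | k₀ , f = suc k₀ , λ where
         (suc k) (s≤s k₀≤k) → conclude r eq ds
           (≈-trans (update-cong (position S) eq (target-cong fl fr Γ (cong suc (+-suc n k)) (↭-sym p')))
                    (update-plug-swap S _))
           (f k k₀≤k)

  principal-right : ∀ {F} → (fl , fr) ∈ rightPremisses F →
                    ∀ {X Ps C ℓ} (r : Rule 𝒜 Ps C ℓ) (eq : X ≈ C) (ds : Ders 𝒜 Ps) → PremissesInverted right F ds →
                    ∀ n i {t} → component C i ≡ just t → ∀ Γ Δ → t ≈s (Γ ++ [] ⇒ F ^ n ++ Δ) →
                    Principal [] (F ^ n) Ps C i → Inverted (by r eq ds) i n Γ Δ
  principal-right q r eq ds ih n i c Γ Δ e (principal k S Γ' Δ' refl refl refl (inj₁ (_ , _ , ())))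
  principal-right q r eq ds ih zero i c Γ Δ e (principal k S Γ' Δ' refl refl refl (inj₂ (_ , _ , ())))
  principal-right {F} q r eq ds ih (suc n) i c Γ Δ e (principal k S Γ' Δ' refl refl refl (inj₂ (P , P∈k , P∈Fⁿ)))
    with ∈-replicate⁻ (suc n) P∈Fⁿ
  ... | refl with principalʳ-kind k P∈k q | just-injective (trans (sym c) (component-plug S _))
  ... | inj₁ refl | refl with e
  ... | seq≈ p p' with ih (∈-map⁺ (premiss S Γ' Δ') q) n
        (occurs (position S) (component-plug S _) (fl ++ Γ) (fr ++ Δ)
                (extend fl fr Γ Δ [] (F ^ n) (seq≈ p (drop-∷ p'))))
  ... | k₀ , f = k₀ , λ k k₀≤k → conclude r eq ds
         (≈-trans (update-cong (position S) eq (target-suc fl fr (n + k) Γ ↭-refl)) (update-plug-swap S _))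
         (f k k₀≤k)
  principal-right {F} q r eq ds ih (suc n) i c Γ Δ e (principal k S Γ' Δ' refl refl refl (inj₂ (P , P∈k , P∈Fⁿ)))
    | refl | inj₂ refl | refl with e
  ... | seq≈ p p' with ih (here refl) (suc (suc n))
        (occurs (position S) (component-plug S _) Γ Δ (seq≈ p (prep F (prep F (drop-∷ p')))))
  ... | k₀ , f = suc k₀ , λ where
         (suc k) (s≤s k₀≤k) → conclude r eq ds
           (≈-trans (update-cong (position S) eq (target-cong fl fr Γ (cong suc (+-suc n k)) ↭-refl))
                    (update-plug-swap S _))
           (f k k₀≤k)

  principal-case : ∀ sd {F} → (fl , fr) ∈ sidePremisses sd F →
                   ∀ {X Ps C ℓ} (r : Rule 𝒜 Ps C ℓ) (eq : X ≈ C) (ds : Ders 𝒜 Ps) → PremissesInverted sd F ds →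
                   ∀ n (o : Occurs (trackedˡ sd F n) (trackedʳ sd F n) C) →
                   Principal (trackedˡ sd F n) (trackedʳ sd F n) Ps C (Occurs.index o) →
                   Inverted (by r eq ds) (Occurs.index o) n (Occurs.Γ o) (Occurs.Δ o)
  principal-case left  q r eq ds ih n (occurs i c Γ Δ e) = principal-left  q r eq ds ih n i c Γ Δ e
  principal-case right q r eq ds ih n (occurs i c Γ Δ e) = principal-right q r eq ds ih n i c Γ Δ e

  module _ (sd : Side) {F : Fm} (q : (fl , fr) ∈ sidePremisses sd F) where

    Tracked : ℕ → Str → Set
    Tracked n = Occurs (trackedˡ sd F n) (trackedʳ sd F n)

    mutual
      invert : ∀ {P} (D : Der 𝒜 P) n (o : Tracked n P) → Inverted D (Occurs.index o) n (Occurs.Γ o) (Occurs.Δ o)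
      invert (by r eq ds) n o
        with principal-or-commutes r (Occurs-≈ eq o) (noBoxes-trackedˡ sd q n) (noBoxes-trackedʳ sd q n)
      ... | inj₁ p = principal-case sd q r eq ds (invert-premiss ds) n (Occurs-≈ eq o) p
      ... | inj₂ (commutes os reapply) with invert* n ds os
      ... | k₀ , f = k₀ , λ k k₀≤k →
            by≈ r eq ds (reapply _ _) (update-cong (Occurs.index o) eq ≈s-refl) (f k k₀≤k)

      invert* : ∀ {Ps} n (ds : Ders 𝒜 Ps) (os : All (MaybeOccurs (trackedˡ sd F n) (trackedʳ sd F n)) Ps) →
                Σ ℕ λ k₀ → ∀ k → k₀ ≤ k →
                  Σ (Ders 𝒜 (replace* os (copies (n + k) fl) (copies (n + k) fr))) (Pres* ds)
      invert* n []       []            = 0 , λ _ _ → [] , []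
      invert* n (d ∷ ds) (nothing ∷ os) with invert* n ds os
      ... | k₀ , f = k₀ , λ k k₀≤k → let ds' , ps = f k k₀≤k in d ∷ ds' , Pres-refl d ∷ ps
      invert* n (d ∷ ds) (just o ∷ os) with invert d n o | invert* n ds os
      ... | k₁ , f | k₂ , g = k₁ ⊔ k₂ , λ k le →
            let d' , p = f k (m⊔n≤o⇒m≤o k₁ k₂ le)
                ds' , ps = g k (m⊔n≤o⇒n≤o k₁ k₂ le)
            in d' ∷ ds' , p ∷ ps

      invert-premiss : ∀ {Ps} (ds : Ders 𝒜 Ps) → PremissesInverted sd F ds
      invert-premiss (d ∷ ds) (here refl) n o with invert d n o
      ... | k₀ , f = k₀ , λ k k₀≤k → let d' , p = f k k₀≤k in d' , Below-head d ds p
      invert-premiss (d ∷ ds) (there Q∈) n o with invert-premiss ds Q∈ n o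
      ... | k₀ , f = k₀ , λ k k₀≤k → let d' , b = f k k₀≤k in d' , Below-tail d ds b

    invertible : ∀ S {s} Γ Δ n (D : Der 𝒜 (plug S s)) → s ≈s (Γ ++ trackedˡ sd F n ⇒ trackedʳ sd F n ++ Δ) →
                 Σ ℕ λ k → D ⊢≼ plug S (target fl fr (n + k) Γ Δ)
    invertible S Γ Δ n D e with invert D n (occurs (position S) (component-plug S _) Γ Δ e)
    ... | k₀ , f with f k₀ ≤-refl
    ... | D' = k₀ , ⊢≼-resp-≈ D' (≈-reflexive (sym (update-plug S _ _)))

inverseˡ : ∀ {𝒜 F fl fr} → (fl , fr) ∈ leftPremisses F → ∀ S Γ Δ n (D : Der 𝒜 (plug S (Γ ++ F ^ n ⇒ Δ))) →
           ∀ {T : ℕ → Seq} → (∀ m → T m ≈s target fl fr m Γ Δ) → Σ ℕ λ k → D ⊢≼ plug S (T (n + k))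
inverseˡ {fl = fl} {fr} q S Γ Δ n D T≈ with invertible fl fr left q S Γ Δ n D ≈s-refl
... | k , D' = k , ⊢≼-resp-≈ D' (plug-cong S (T≈ (n + k)))

inverseʳ : ∀ {𝒜 F fl fr} → (fl , fr) ∈ rightPremisses F → ∀ S Γ Δ n (D : Der 𝒜 (plug S (Γ ⇒ F ^ n ++ Δ))) →
           ∀ {T : ℕ → Seq} → (∀ m → T m ≈s target fl fr m Γ Δ) → Σ ℕ λ k → D ⊢≼ plug S (T (n + k))
inverseʳ {fl = fl} {fr} q S Γ Δ n D T≈
  with invertible fl fr right q S Γ Δ n D (seq≈ (↭-reflexive (sym (++-identityʳ Γ))) ↭-refl)
... | k , D' = k , ⊢≼-resp-≈ D' (plug-cong S (T≈ (n + k)))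

copies-[] : ∀ m → copies m [] ≡ []
copies-[] zero    = refl
copies-[] (suc m) = copies-[] m

copies-single : ∀ A m → copies m (A ∷ []) ≡ A ^ m
copies-single A zero    = refl
copies-single A (suc m) = cong (A ∷_) (copies-single A m)

copies-pair : ∀ A B m → A ^ m ++ B ^ m ↭ copies m (A ∷ B ∷ [])
copies-pair A B zero    = ↭-refl
copies-pair A B (suc m) = prep A (↭-trans (shift B (A ^ m) (B ^ m)) (prep B (copies-pair A B m)))

antecedent-∅ : ∀ Γ m → Γ ↭ Γ ++ copies m []
antecedent-∅ Γ m = ↭-reflexive (sym (trans (cong (Γ ++_) (copies-[] m)) (++-identityʳ Γ)))

succedent-∅ : ∀ Δ m → Δ ↭ copies m [] ++ Δ
succedent-∅ Δ m = ↭-reflexive (cong (_++ Δ) (sym (copies-[] m)))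

succedent-copies : ∀ A Γ Δ m → (Γ ⇒ A ^ m ++ Δ) ≈s target [] (A ∷ []) m Γ Δ
succedent-copies A Γ Δ m = seq≈ (antecedent-∅ Γ m) (↭-reflexive (cong (_++ Δ) (sym (copies-single A m))))

antecedent-copies : ∀ A Γ Δ m → (Γ ++ A ^ m ⇒ Δ) ≈s target (A ∷ []) [] m Γ Δ
antecedent-copies A Γ Δ m = seq≈ (↭-reflexive (cong (Γ ++_) (sym (copies-single A m)))) (succedent-∅ Δ m)

both-copies : ∀ A B Γ Δ m → (Γ ++ A ^ m ⇒ B ^ m ++ Δ) ≈s target (A ∷ []) (B ∷ []) m Γ Δ
both-copies A B Γ Δ m = seq≈ (↭-reflexive (cong (Γ ++_) (sym (copies-single A m))))
                             (↭-reflexive (cong (_++ Δ) (sym (copies-single B m))))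

succedent-pair : ∀ A B Γ Δ m → (Γ ⇒ A ^ m ++ B ^ m ++ Δ) ≈s target [] (A ∷ B ∷ []) m Γ Δ
succedent-pair A B Γ Δ m =
  seq≈ (antecedent-∅ Γ m) (↭-trans (↭-reflexive (sym (++-assoc (A ^ m) (B ^ m) Δ))) (++⁺ʳ Δ (copies-pair A B m)))

antecedent-pair : ∀ A B Γ Δ m → (Γ ++ A ^ m ++ B ^ m ⇒ Δ) ≈s target (A ∷ B ∷ []) [] m Γ Δ
antecedent-pair A B Γ Δ m = seq≈ (++⁺ˡ Γ (copies-pair A B m)) (succedent-∅ Δ m)

part1 : ∀ 𝒜 n → Part1 𝒜 n
part1 𝒜 n S Γ Δ A D = inverseˡ (here refl) S Γ Δ n D (succedent-copies A Γ Δ)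

part2 : ∀ 𝒜 n → Part2 𝒜 n
part2 𝒜 n S Γ Δ A D = inverseʳ (here refl) S Γ Δ n D (antecedent-copies A Γ Δ)

part3 : ∀ 𝒜 n → Part3 𝒜 n
part3 𝒜 n S Γ Δ A B D with inverseˡ (here refl) S Γ Δ n D (antecedent-copies B Γ Δ)
                          | inverseˡ (there (here refl)) S Γ Δ n D (succedent-copies A Γ Δ)
... | k , D₁ | l , D₂ = k , l , D₁ , D₂

part4 : ∀ 𝒜 n → Part4 𝒜 n
part4 𝒜 n S Γ Δ A B D with inverseʳ (here refl) S Γ Δ n D (both-copies A B Γ Δ)
... | k , D' = k , k , D'

part5 : ∀ 𝒜 n → Part5 𝒜 n
part5 𝒜 n S Γ Δ A B D with inverseˡ (here refl) S Γ Δ n D (antecedent-copies A Γ Δ)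
                          | inverseˡ (there (here refl)) S Γ Δ n D (antecedent-copies B Γ Δ)
... | k , D₁ | l , D₂ = k , l , D₁ , D₂

part6 : ∀ 𝒜 n → Part6 𝒜 n
part6 𝒜 n S Γ Δ A B D with inverseʳ (here refl) S Γ Δ n D (succedent-pair A B Γ Δ)
... | k , D' = k , k , D'

part7 : ∀ 𝒜 n → Part7 𝒜 n
part7 𝒜 n S Γ Δ A B D with inverseˡ (here refl) S Γ Δ n D (antecedent-pair A B Γ Δ)
... | k , D' = k , k , D'

part8 : ∀ 𝒜 n → Part8 𝒜 n
part8 𝒜 n S Γ Δ A B D with inverseʳ (here refl) S Γ Δ n D (succedent-copies A Γ Δ)
                          | inverseʳ (there (here refl)) S Γ Δ n D (succedent-copies B Γ Δ)
... | k , D₁ | l , D₂ = k , l , D₁ , D₂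

-- The inversions hold for n = 0 as well.
mainTheorem8 : (𝒜 : Axioms) (n : ℕ) → 1 ≤ n →
    Part1 𝒜 n × Part2 𝒜 n × Part3 𝒜 n × Part4 𝒜 n ×
    Part5 𝒜 n × Part6 𝒜 n × Part7 𝒜 n × Part8 𝒜 n
mainTheorem8 𝒜 n _ =
  part1 𝒜 n , part2 𝒜 n , part3 𝒜 n , part4 𝒜 n , part5 𝒜 n , part6 𝒜 n , part7 𝒜 n , part8 𝒜 n
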